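{- Let $k>d\geq1$ and let $\tau=\tau'\mbox{ - }(d+1)(d+2)\cdots k$ be a generalized pattern, where $\tau'$ is a generalized pattern on the letters $\{1,\dots,d\}$ and the block $(d+1)(d+2)\cdots k$ has no internal dashes. Then $$F_\tau(x)=\sum_{j=0}^{k-d-1}\bigl(xF_\tau(x)\bigr)^j+x^{k-d}F_\tau^{k-d}(x)F_{\tau'}(x).$$
   Context: A generalized pattern is a permutation of a set of letters written as a word $\tau_1\cdots\tau_k$ in which each pair of adjacent letters may or may not be separated by a dash "-". A permutation $\pi=\pi_1\cdots\pi_n\in S_n$ contains $\tau$ if there are indices $i_1<\dots<i_k$ with $(\pi_{i_1},\dots,\pi_{i_k})$ order-isomorphic to $(\tau_1,\dots,\tau_k)$ and $i_{j+1}=i_j+1$ whenever $\tau_j,\tau_{j+1}$ are not separated by a dash; otherwise $\pi$ avoids $\tau$. Thus $1\mbox{ - }3\mbox{ - }2$ is the classical pattern $132$. $F_\tau(x)=\sum_{n\geq0}f_\tau(n)x^n$, where $f_\tau(n)$ is the number of permutations in $S_n$ ($S_0$ = the empty permutation) avoiding both $1\mbox{ - }3\mbox{ - }2$ and $\tau$. -}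

module Defs where

open import Data.Nat using (ℕ; zero; suc; _+_; _*_; _∸_; _≤ᵇ_; _<ᵇ_)
open import Data.Bool using (Bool; true; false; _∧_; not; if_then_else_)
open import Data.List using (List; []; _∷_; [_]; _++_; map; concat; concatMap; length; take; drop; upTo; filterᵇ; zipWith)
open import Data.Bool.ListAction using (any; and)
open import Data.Nat.ListAction using (sum)

-- A generalized pattern is written as a list of blocks: letters inside a
-- block are adjacent (no dash), consecutive blocks are separated by a dash.
-- E.g. 1-3-2 = ((1)(3)(2)),  1-23 = ((1)(2 3)).  Letters are 1..k.

GPat : Set
GPat = List (List ℕ)

p132 : GPat
p132 = (1 ∷ []) ∷ (3 ∷ []) ∷ (2 ∷ []) ∷ []

_==_ : Bool → Bool → Bool
true  == b = b
false == b = not b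

ordIso : List ℕ → List ℕ → Bool
ordIso [] [] = true
ordIso (x ∷ xs) (y ∷ ys) =
  and (zipWith (λ x' y' → (x <ᵇ x') == (y <ᵇ y')) xs ys)
  ∧ (and (zipWith (λ x' y' → (x' <ᵇ x) == (y' <ᵇ y)) xs ys)
  ∧ ordIso xs ys)
ordIso _ _ = false

-- All value-sequences of π obtained by choosing, for each block b (in order),
-- a factor (= consecutive segment) of π of length |b|, these factors being
-- non-overlapping and in increasing position order.
occs : GPat → List ℕ → List (List ℕ)
occs [] π = [] ∷ []
occs (b ∷ bs) [] = []
occs (b ∷ bs) (x ∷ π) =
  (if length b ≤ᵇ length (x ∷ π)
     then map (take (length b) (x ∷ π) ++_) (occs bs (drop (length b) (x ∷ π)))
     else [])
  ++ occs (b ∷ bs) π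

contains : GPat → List ℕ → Bool
contains τ π = any (ordIso (concat τ)) (occs τ π)

avoids : GPat → List ℕ → Bool
avoids τ π = not (contains τ π)

-- S_n: all permutations of 1..n (one-line notation), built by inserting n.

insertions : ℕ → List ℕ → List (List ℕ)
insertions x [] = (x ∷ []) ∷ []
insertions x (y ∷ ys) = (x ∷ y ∷ ys) ∷ map (y ∷_) (insertions x ys)

perms : ℕ → List (List ℕ)
perms zero = [] ∷ []
perms (suc n) = concatMap (insertions (suc n)) (perms n)

f : GPat → ℕ → ℕ
f τ n = length (filterᵇ (λ π → avoids p132 π ∧ avoids τ π) (perms n))

Series : Set
Series = ℕ → ℕ

_⊕_ : Series → Series → Series
(a ⊕ b) n = a n + b n

_⊛_ : Series → Series → Series
(a ⊛ b) n = sum (map (λ i → a i * b (n ∸ i)) (upTo (suc n)))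

oneS : Series
oneS zero = 1
oneS (suc _) = 0

X : Series
X 1 = 1
X _ = 0

_^ˢ_ : Series → ℕ → Series
a ^ˢ zero = oneS
a ^ˢ suc m = a ⊛ (a ^ˢ m)

ΣS : ℕ → (ℕ → Series) → Series
ΣS zero g n = 0
ΣS (suc m) g n = ΣS m g n + g m n

range1 : ℕ → List ℕ
range1 d = map suc (upTo d)

block : ℕ → ℕ → List ℕ
block d k = map (λ i → d + suc i) (upTo (k ∸ d))

-- A nonempty 132-avoider of length n+1 is uniquely α′ (n+1) β with α′ and β 132-avoiders,
-- α′ on the largest letters and β on the smallest. Let H_r count the 132-avoiders π such
-- that π followed by r increasing letters above π avoids τ. Then H_0 = F_τ, and
-- H_(k-d) = F_τ′ because k-d such letters complete the final block after any occurrence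
-- of τ′. For r < k-d, an occurrence of τ in α′ (n+1) β ρ, with ρ that run, lies in
-- α′ (n+1) or in β ρ: its final block is increasing, so it cannot run past n+1, and a
-- block starting in β ρ starts in β (ρ is too short), so the part matching τ′ lies below
-- it, inside β. Hence H_r = 1 + x (H_(r+1) + H_1 (H_r - 1)), that is H_r = 1 + x F_τ H_(r+1),
-- which unrolls to the formula.

module Submission where

open import Defs
open import Data.Nat using (ℕ; zero; suc; _+_; _*_; _∸_; _≤_; _<_; z≤n; s≤s; _<ᵇ_; _≤ᵇ_; _≟_; _≤?_; _<?_)
open import Data.Nat.Properties
open import Data.Nat.ListAction using (sum)
open import Data.Bool using (Bool; true; false; _∧_; _∨_; not; if_then_else_; T?)
open import Data.Bool.Properties using (T-≡; ∧-zeroʳ; ∧-identityʳ; ∧-assoc; ∧-conicalˡ; ∧-conicalʳ)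
open import Data.Bool.ListAction using (and; any)
open import Data.List using (List; []; _∷_; [_]; _++_; map; concat; concatMap; length; take; drop; zipWith; upTo; applyUpTo; filter; filterᵇ; cartesianProduct)
open import Data.List.Properties
  using (length-map; length-++; length-take; length-upTo; length-applyUpTo; length-++-≤ˡ; length-++-≤ʳ; ++-assoc; ++-identityʳ;
         map-++; map-∘; map-cong; map-cong-local; map-id; map-id-local; map-upTo; map-applyUpTo; map-injective; take-map; drop-map;
         take++drop≡id; upTo-∷ʳ; concat-++; zipWith-cong; filter-++; filter-all; filter-none; ∷-injective; ∷-injectiveˡ; ∷-injectiveʳ)
open import Data.List.Extrema.Nat using (max; xs≤max; max≤v⁺; max<v⁺)
open import Data.List.Membership.Propositional using (_∈_; _∉_; find; lose)
open import Data.List.Membership.Propositional.Properties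
  using (∈-++⁺ˡ; ∈-++⁺ʳ; ∈-++⁻; ∈-map⁺; ∈-map⁻; ∈-∃++; ∈-filter⁺; ∈-filter⁻; ∈-concat⁺′; ∈-concat⁻′; ∈-upTo⁺; ∈-upTo⁻;
         ∈-applyUpTo⁻; ∈-cartesianProduct⁺; ∈-cartesianProduct⁻)
open import Data.List.Membership.Propositional.Properties.WithK using (unique∧set⇒bag)
open import Data.List.Relation.Unary.Any using (here; there)
open import Data.List.Relation.Unary.Any.Properties using (any⁺; any⁻)
open import Data.List.Relation.Unary.All using (All; []; _∷_)
import Data.List.Relation.Unary.All as All
import Data.List.Relation.Unary.All.Properties as AllP
open import Data.List.Relation.Unary.AllPairs using ([]; _∷_)
open import Data.List.Relation.Unary.Linked using (Linked; []; [-]; _∷_)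
import Data.List.Relation.Unary.Linked as Linked
open import Data.List.Relation.Unary.Linked.Properties using (Linked⇒AllPairs; applyUpTo⁺₂)
open import Data.List.Relation.Unary.Unique.Propositional using (Unique)
import Data.List.Relation.Unary.Unique.Propositional.Properties as Unique
open import Data.List.Relation.Binary.BagAndSetEquality using (∼bag⇒↭)
open import Data.List.Relation.Binary.Permutation.Propositional
  using (_↭_; ↭-refl; ↭-sym; ↭-trans; prep; swap; ↭⇒↭ₛ; module PermutationReasoning)
open import Data.List.Relation.Binary.Permutation.Propositional.Properties
  using (∈-resp-↭; ↭-length; ↭-empty-inv; drop-mid; ∷↭∷ʳ; filter-↭; shift; ++⁺; ++-comm)
import Data.List.Relation.Binary.Permutation.Propositional.Properties as ↭
open import Relation.Binary.PropositionalEquality.Properties using (setoid)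
open import Data.List.Relation.Binary.Permutation.Setoid.Properties (setoid ℕ) using (Unique-resp-↭)
open import Data.Product using (Σ; _×_; _,_; proj₁; proj₂; uncurry)
open import Data.Sum using (_⊎_; inj₁; inj₂; [_,_]′; map₂)
open import Data.Empty using (⊥-elim)
open import Function using (_∘_)
open import Function.Bundles using (Equivalence; mk⇔)
open import Relation.Nullary using (¬_; yes; no; does; contradiction)
open import Relation.Nullary.Decidable using (dec-true; dec-false)
open import Relation.Binary.Definitions using (tri<; tri≈; tri>)
open import Relation.Binary.PropositionalEquality hiding ([_])
import Algebra.Properties.CommutativeSemigroup +-commutativeSemigroup as +-CS

module PowerSeries where

  open ≡-Reasoning

  tailˢ : Series → Series
  tailˢ a i = a (suc i)

  -- The Cauchy product with the first factor unfolded one coefficient at a time, the form of _⊛_ that supports induction.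
  conv : Series → Series → Series
  conv a b zero = a 0 * b 0
  conv a b (suc n) = a 0 * b (suc n) + conv (tailˢ a) b n

  sumBelow : (ℕ → ℕ) → ℕ → ℕ
  sumBelow g zero = 0
  sumBelow g (suc n) = g 0 + sumBelow (g ∘ suc) n

  sum-map-applyUpTo : ∀ (g h : ℕ → ℕ) n → sum (map g (applyUpTo h n)) ≡ sumBelow (g ∘ h) n
  sum-map-applyUpTo g h zero = refl
  sum-map-applyUpTo g h (suc n) = cong (g (h 0) +_) (sum-map-applyUpTo g (h ∘ suc) n)

  sum-map-upTo : ∀ (g : ℕ → ℕ) n → sum (map g (upTo n)) ≡ sumBelow g n
  sum-map-upTo g = sum-map-applyUpTo g (λ i → i)

  sumBelow-cong : ∀ {g h} n → (∀ i → i < n → g i ≡ h i) → sumBelow g n ≡ sumBelow h n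
  sumBelow-cong zero _ = refl
  sumBelow-cong (suc n) g≡h = cong₂ _+_ (g≡h 0 (s≤s z≤n)) (sumBelow-cong n (λ i i<n → g≡h (suc i) (s≤s i<n)))

  sumBelow-suc : ∀ g n → sumBelow g (suc n) ≡ sumBelow g n + g n
  sumBelow-suc g zero = +-comm (g 0) 0
  sumBelow-suc g (suc n) = begin
    g 0 + sumBelow (g ∘ suc) (suc n)    ≡⟨ cong (g 0 +_) (sumBelow-suc (g ∘ suc) n) ⟩
    g 0 + (sumBelow (g ∘ suc) n + g (suc n)) ≡⟨ +-assoc (g 0) _ _ ⟨
    g 0 + sumBelow (g ∘ suc) n + g (suc n) ∎

  ⊛≗conv : ∀ a b → a ⊛ b ≗ conv a b
  ⊛≗conv a b n = trans (sum-map-upTo (λ i → a i * b (n ∸ i)) (suc n)) (go a n)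
    where
    go : ∀ a n → sumBelow (λ i → a i * b (n ∸ i)) (suc n) ≡ conv a b n
    go a zero = +-identityʳ (a 0 * b 0)
    go a (suc n) = cong (a 0 * b (suc n) +_) (go (tailˢ a) n)

  conv-cong : ∀ {a a′ b b′} → a ≗ a′ → b ≗ b′ → conv a b ≗ conv a′ b′
  conv-cong a≗ b≗ zero = cong₂ _*_ (a≗ 0) (b≗ 0)
  conv-cong a≗ b≗ (suc n) = cong₂ _+_ (cong₂ _*_ (a≗ 0) (b≗ (suc n))) (conv-cong (a≗ ∘ suc) b≗ n)

  conv-congʳ-upTo : ∀ a {b b′} n → (∀ i → i ≤ n → b i ≡ b′ i) → conv a b n ≡ conv a b′ n
  conv-congʳ-upTo a zero b≡ = cong (a 0 *_) (b≡ 0 z≤n)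
  conv-congʳ-upTo a (suc n) b≡ =
    cong₂ _+_ (cong (a 0 *_) (b≡ (suc n) ≤-refl)) (conv-congʳ-upTo (tailˢ a) n (λ i i≤n → b≡ i (m≤n⇒m≤1+n i≤n)))

  conv-zeroˡ : ∀ {a} b → (∀ i → a i ≡ 0) → ∀ n → conv a b n ≡ 0
  conv-zeroˡ b a≡0 zero rewrite a≡0 0 = refl
  conv-zeroˡ b a≡0 (suc n) rewrite a≡0 0 = conv-zeroˡ b (a≡0 ∘ suc) n

  conv-distribʳ : ∀ a a′ b → conv (a ⊕ a′) b ≗ conv a b ⊕ conv a′ b
  conv-distribʳ a a′ b zero = *-distribʳ-+ (b 0) (a 0) (a′ 0)
  conv-distribʳ a a′ b (suc n) = begin
    (a 0 + a′ 0) * b (suc n) + conv (tailˢ (a ⊕ a′)) b n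
      ≡⟨ cong₂ _+_ (*-distribʳ-+ (b (suc n)) (a 0) (a′ 0)) (conv-distribʳ (tailˢ a) (tailˢ a′) b n) ⟩
    (a 0 * b (suc n) + a′ 0 * b (suc n)) + (conv (tailˢ a) b n + conv (tailˢ a′) b n)
      ≡⟨ +-CS.interchange (a 0 * b (suc n)) _ _ _ ⟩
    (a 0 * b (suc n) + conv (tailˢ a) b n) + (a′ 0 * b (suc n) + conv (tailˢ a′) b n) ∎

  conv-distribˡ : ∀ a b b′ → conv a (b ⊕ b′) ≗ conv a b ⊕ conv a b′
  conv-distribˡ a b b′ zero = *-distribˡ-+ (a 0) (b 0) (b′ 0)
  conv-distribˡ a b b′ (suc n) = begin
    a 0 * (b (suc n) + b′ (suc n)) + conv (tailˢ a) (b ⊕ b′) n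
      ≡⟨ cong₂ _+_ (*-distribˡ-+ (a 0) (b (suc n)) (b′ (suc n))) (conv-distribˡ (tailˢ a) b b′ n) ⟩
    (a 0 * b (suc n) + a 0 * b′ (suc n)) + (conv (tailˢ a) b n + conv (tailˢ a) b′ n)
      ≡⟨ +-CS.interchange (a 0 * b (suc n)) _ _ _ ⟩
    (a 0 * b (suc n) + conv (tailˢ a) b n) + (a 0 * b′ (suc n) + conv (tailˢ a) b′ n) ∎

  conv-scaleˡ : ∀ c a b n → conv (λ i → c * a i) b n ≡ c * conv a b n
  conv-scaleˡ c a b zero = *-assoc c (a 0) (b 0)
  conv-scaleˡ c a b (suc n) = begin
    c * a 0 * b (suc n) + conv (λ i → c * a (suc i)) b n ≡⟨ cong₂ _+_ (*-assoc c (a 0) (b (suc n))) (conv-scaleˡ c (tailˢ a) b n) ⟩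
    c * (a 0 * b (suc n)) + c * conv (tailˢ a) b n      ≡⟨ *-distribˡ-+ c _ _ ⟨
    c * (a 0 * b (suc n) + conv (tailˢ a) b n)          ∎

  conv-comm : ∀ a b → conv a b ≗ conv b a
  conv-comm a b zero = *-comm (a 0) (b 0)
  conv-comm a b (suc zero) = begin
    a 0 * b 1 + a 1 * b 0 ≡⟨ +-comm (a 0 * b 1) _ ⟩
    a 1 * b 0 + a 0 * b 1 ≡⟨ cong₂ _+_ (*-comm (a 1) (b 0)) (*-comm (a 0) (b 1)) ⟩
    b 0 * a 1 + b 1 * a 0 ∎
  conv-comm a b (suc (suc n)) = begin
    a 0 * b (2 + n) + conv (tailˢ a) b (suc n)
      ≡⟨ cong (a 0 * b (2 + n) +_) (conv-comm (tailˢ a) b (suc n)) ⟩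
    a 0 * b (2 + n) + (b 0 * a (2 + n) + conv (tailˢ b) (tailˢ a) n)
      ≡⟨ cong (λ x → a 0 * b (2 + n) + (b 0 * a (2 + n) + x)) (conv-comm (tailˢ b) (tailˢ a) n) ⟩
    a 0 * b (2 + n) + (b 0 * a (2 + n) + conv (tailˢ a) (tailˢ b) n)
      ≡⟨ +-CS.x∙yz≈y∙xz (a 0 * b (2 + n)) (b 0 * a (2 + n)) _ ⟩
    b 0 * a (2 + n) + (a 0 * b (2 + n) + conv (tailˢ a) (tailˢ b) n)
      ≡⟨ cong (b 0 * a (2 + n) +_) (conv-comm a (tailˢ b) (suc n)) ⟩
    b 0 * a (2 + n) + conv (tailˢ b) a (suc n) ∎

  conv-assoc : ∀ a b c → conv (conv a b) c ≗ conv a (conv b c)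
  conv-assoc a b c zero = *-assoc (a 0) (b 0) (c 0)
  conv-assoc a b c (suc n) = begin
    a 0 * b 0 * c (suc n) + conv (tailˢ (conv a b)) c n
      ≡⟨ cong (a 0 * b 0 * c (suc n) +_) (conv-distribʳ (λ i → a 0 * b (suc i)) (conv (tailˢ a) b) c n) ⟩
    a 0 * b 0 * c (suc n) + (conv (λ i → a 0 * b (suc i)) c n + conv (conv (tailˢ a) b) c n)
      ≡⟨ cong₂ (λ x y → a 0 * b 0 * c (suc n) + (x + y)) (conv-scaleˡ (a 0) (tailˢ b) c n) (conv-assoc (tailˢ a) b c n) ⟩
    a 0 * b 0 * c (suc n) + (a 0 * conv (tailˢ b) c n + conv (tailˢ a) (conv b c) n)
      ≡⟨ +-assoc (a 0 * b 0 * c (suc n)) _ _ ⟨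
    (a 0 * b 0 * c (suc n) + a 0 * conv (tailˢ b) c n) + conv (tailˢ a) (conv b c) n
      ≡⟨ cong (λ x → (x + a 0 * conv (tailˢ b) c n) + conv (tailˢ a) (conv b c) n) (*-assoc (a 0) (b 0) (c (suc n))) ⟩
    (a 0 * (b 0 * c (suc n)) + a 0 * conv (tailˢ b) c n) + conv (tailˢ a) (conv b c) n
      ≡⟨ cong (_+ conv (tailˢ a) (conv b c) n) (*-distribˡ-+ (a 0) _ _) ⟨
    a 0 * (b 0 * c (suc n) + conv (tailˢ b) c n) + conv (tailˢ a) (conv b c) n ∎

  conv-identityˡ : ∀ b → conv oneS b ≗ b
  conv-identityˡ b zero = +-identityʳ (b 0)
  conv-identityˡ b (suc n) =
    trans (cong₂ _+_ (+-identityʳ (b (suc n))) (conv-zeroˡ b (λ _ → refl) n)) (+-identityʳ (b (suc n)))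

  tailˢ-X : tailˢ X ≗ oneS
  tailˢ-X zero = refl
  tailˢ-X (suc i) = refl

  ⊛-cong : ∀ {a a′ b b′} → a ≗ a′ → b ≗ b′ → a ⊛ b ≗ a′ ⊛ b′
  ⊛-cong {a} {a′} {b} {b′} a≗ b≗ n = trans (⊛≗conv a b n) (trans (conv-cong a≗ b≗ n) (sym (⊛≗conv a′ b′ n)))

  ⊛-congˡ : ∀ {a a′} b → a ≗ a′ → a ⊛ b ≗ a′ ⊛ b
  ⊛-congˡ b a≗ = ⊛-cong {b = b} {b′ = b} a≗ (λ _ → refl)

  ⊛-congʳ : ∀ a {b b′} → b ≗ b′ → a ⊛ b ≗ a ⊛ b′
  ⊛-congʳ a b≗ = ⊛-cong {a} {a} (λ _ → refl) b≗

  ⊛-comm : ∀ a b → a ⊛ b ≗ b ⊛ a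
  ⊛-comm a b n = trans (⊛≗conv a b n) (trans (conv-comm a b n) (sym (⊛≗conv b a n)))

  ⊛-assoc : ∀ a b c → (a ⊛ b) ⊛ c ≗ a ⊛ (b ⊛ c)
  ⊛-assoc a b c n = begin
    ((a ⊛ b) ⊛ c) n   ≡⟨ ⊛≗conv (a ⊛ b) c n ⟩
    conv (a ⊛ b) c n  ≡⟨ conv-cong (⊛≗conv a b) (λ _ → refl) n ⟩
    conv (conv a b) c n ≡⟨ conv-assoc a b c n ⟩
    conv a (conv b c) n ≡⟨ conv-cong (λ _ → refl) (⊛≗conv b c) n ⟨
    conv a (b ⊛ c) n  ≡⟨ ⊛≗conv a (b ⊛ c) n ⟨
    (a ⊛ (b ⊛ c)) n   ∎

  ⊛-distribʳ : ∀ a a′ b → (a ⊕ a′) ⊛ b ≗ (a ⊛ b) ⊕ (a′ ⊛ b)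
  ⊛-distribʳ a a′ b n =
    trans (⊛≗conv (a ⊕ a′) b n) (trans (conv-distribʳ a a′ b n) (sym (cong₂ _+_ (⊛≗conv a b n) (⊛≗conv a′ b n))))

  ⊛-distribˡ : ∀ a b b′ → a ⊛ (b ⊕ b′) ≗ (a ⊛ b) ⊕ (a ⊛ b′)
  ⊛-distribˡ a b b′ n =
    trans (⊛≗conv a (b ⊕ b′) n) (trans (conv-distribˡ a b b′ n) (sym (cong₂ _+_ (⊛≗conv a b n) (⊛≗conv a b′ n))))

  ⊛-identityˡ : ∀ b → oneS ⊛ b ≗ b
  ⊛-identityˡ b n = trans (⊛≗conv oneS b n) (conv-identityˡ b n)

  ⊛-identityʳ : ∀ a → a ⊛ oneS ≗ a
  ⊛-identityʳ a n = trans (⊛-comm a oneS n) (⊛-identityˡ a n)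

  ⊛-zeroʳ : ∀ a → a ⊛ (λ _ → 0) ≗ (λ _ → 0)
  ⊛-zeroʳ a n = trans (⊛-comm a _ n) (trans (⊛≗conv _ a n) (conv-zeroˡ a (λ _ → refl) n))

  X⊛-zero : ∀ b → (X ⊛ b) 0 ≡ 0
  X⊛-zero b = ⊛≗conv X b 0

  X⊛-suc : ∀ b n → (X ⊛ b) (suc n) ≡ b n
  X⊛-suc b n = trans (⊛≗conv X b (suc n)) (trans (conv-cong tailˢ-X (λ _ → refl) n) (conv-identityˡ b n))

  ⊛-interchange : ∀ a b c d → (a ⊛ b) ⊛ (c ⊛ d) ≗ (a ⊛ c) ⊛ (b ⊛ d)
  ⊛-interchange a b c d n = begin
    ((a ⊛ b) ⊛ (c ⊛ d)) n ≡⟨ ⊛-assoc a b (c ⊛ d) n ⟩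
    (a ⊛ (b ⊛ (c ⊛ d))) n ≡⟨ ⊛-congʳ a (λ i → sym (⊛-assoc b c d i)) n ⟩
    (a ⊛ ((b ⊛ c) ⊛ d)) n ≡⟨ ⊛-congʳ a (⊛-congˡ d (⊛-comm b c)) n ⟩
    (a ⊛ ((c ⊛ b) ⊛ d)) n ≡⟨ ⊛-congʳ a (⊛-assoc c b d) n ⟩
    (a ⊛ (c ⊛ (b ⊛ d))) n ≡⟨ ⊛-assoc a c (b ⊛ d) n ⟨
    ((a ⊛ c) ⊛ (b ⊛ d)) n ∎

  ^ˢ-cong : ∀ {a b} → a ≗ b → ∀ j → a ^ˢ j ≗ b ^ˢ j
  ^ˢ-cong a≗b zero = λ _ → refl
  ^ˢ-cong a≗b (suc j) = ⊛-cong a≗b (^ˢ-cong a≗b j)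

  ΣS-cong : ∀ {g g′ : ℕ → Series} j → (∀ i → g i ≗ g′ i) → ΣS j g ≗ ΣS j g′
  ΣS-cong zero g≗ n = refl
  ΣS-cong (suc j) g≗ n = cong₂ _+_ (ΣS-cong j g≗ n) (g≗ j n)

  ⊛-ΣS : ∀ a j g → a ⊛ ΣS j g ≗ ΣS j (λ i → a ⊛ g i)
  ⊛-ΣS a zero g = ⊛-zeroʳ a
  ⊛-ΣS a (suc j) g n = trans (⊛-distribˡ a (ΣS j g) (g j) n) (cong (_+ (a ⊛ g j) n) (⊛-ΣS a j g n))

  ΣS-suc : ∀ j g → ΣS (suc j) g ≗ g 0 ⊕ ΣS j (g ∘ suc)
  ΣS-suc zero g n = sym (+-identityʳ (g 0 n))
  ΣS-suc (suc j) g n = begin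
    ΣS (suc j) g n + g (suc j) n                ≡⟨ cong (_+ g (suc j) n) (ΣS-suc j g n) ⟩
    g 0 n + ΣS j (g ∘ suc) n + g (suc j) n      ≡⟨ +-assoc (g 0 n) _ _ ⟩
    g 0 n + (ΣS j (g ∘ suc) n + g (suc j) n)    ∎

  constant-one : ∀ a → a 0 ≡ 1 → a ≗ oneS ⊕ (X ⊛ tailˢ a)
  constant-one a a₀≡1 zero = trans a₀≡1 (cong (1 +_) (sym (X⊛-zero (tailˢ a))))
  constant-one a _ (suc n) = sym (X⊛-suc (tailˢ a) n)

  -- The coefficient of x^n on the right only involves Y 0, …, Y (n-1).
  X-recursion-unique : ∀ a B Y Y′ → Y ≗ B ⊕ (X ⊛ (a ⊛ Y)) → Y′ ≗ B ⊕ (X ⊛ (a ⊛ Y′)) → Y ≗ Y′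
  X-recursion-unique a B Y Y′ Y≗ Y′≗ n = below (suc n) n ≤-refl
    where
    below : ∀ N i → i < N → Y i ≡ Y′ i
    below (suc N) zero _ = trans (Y≗ 0) (trans (cong (B 0 +_) (trans (X⊛-zero (a ⊛ Y)) (sym (X⊛-zero (a ⊛ Y′))))) (sym (Y′≗ 0)))
    below (suc N) (suc i) (s≤s i<N) = begin
      Y (suc i)                      ≡⟨ Y≗ (suc i) ⟩
      B (suc i) + (X ⊛ (a ⊛ Y)) (suc i) ≡⟨ cong (B (suc i) +_) (X⊛-suc (a ⊛ Y) i) ⟩
      B (suc i) + (a ⊛ Y) i          ≡⟨ cong (B (suc i) +_) (⊛≗conv a Y i) ⟩
      B (suc i) + conv a Y i         ≡⟨ cong (B (suc i) +_) (conv-congʳ-upTo a i (λ j j≤i → below N j (≤-<-trans j≤i i<N))) ⟩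
      B (suc i) + conv a Y′ i        ≡⟨ cong (B (suc i) +_) (⊛≗conv a Y′ i) ⟨
      B (suc i) + (a ⊛ Y′) i         ≡⟨ cong (B (suc i) +_) (X⊛-suc (a ⊛ Y′) i) ⟨
      B (suc i) + (X ⊛ (a ⊛ Y′)) (suc i) ≡⟨ Y′≗ (suc i) ⟨
      Y′ (suc i)                     ∎

  closedForm : ℕ → Series → Series → Series
  closedForm j F F′ = ΣS j ((X ⊛ F) ^ˢ_) ⊕ (((X ^ˢ j) ⊛ (F ^ˢ j)) ⊛ F′)

  closedForm-congˡ : ∀ j {F G} F′ → F ≗ G → closedForm j F F′ ≗ closedForm j G F′
  closedForm-congˡ j F′ F≗G n =
    cong₂ _+_ (ΣS-cong j (^ˢ-cong (⊛-congʳ X F≗G)) n) (⊛-congˡ F′ (⊛-congʳ (X ^ˢ j) (^ˢ-cong F≗G j)) n)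

  closedForm-suc : ∀ j F F′ → oneS ⊕ (X ⊛ (F ⊛ closedForm j F F′)) ≗ closedForm (suc j) F F′
  closedForm-suc j F F′ n = begin
    oneS n + (X ⊛ (F ⊛ closedForm j F F′)) n          ≡⟨ cong (oneS n +_) (⊛-assoc X F (closedForm j F F′) n) ⟨
    oneS n + (G ⊛ closedForm j F F′) n                ≡⟨ cong (oneS n +_) (⊛-distribˡ G (ΣS j (G ^ˢ_)) tail n) ⟩
    oneS n + ((G ⊛ ΣS j (G ^ˢ_)) n + (G ⊛ tail) n)       ≡⟨ cong₂ (λ x y → oneS n + (x + y)) (⊛-ΣS G j (G ^ˢ_) n) G⊛tail ⟩
    oneS n + (ΣS j (λ i → G ^ˢ suc i) n + tail′ n)        ≡⟨ +-assoc (oneS n) _ _ ⟨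
    (oneS n + ΣS j (λ i → G ^ˢ suc i) n) + tail′ n        ≡⟨ cong (_+ tail′ n) (ΣS-suc j (G ^ˢ_) n) ⟨
    ΣS (suc j) (G ^ˢ_) n + tail′ n                       ∎
    where
    G = X ⊛ F
    tail = ((X ^ˢ j) ⊛ (F ^ˢ j)) ⊛ F′
    tail′ = ((X ^ˢ suc j) ⊛ (F ^ˢ suc j)) ⊛ F′
    G⊛tail : (G ⊛ tail) n ≡ tail′ n
    G⊛tail = trans (sym (⊛-assoc G ((X ^ˢ j) ⊛ (F ^ˢ j)) F′ n)) (⊛-congˡ F′ (⊛-interchange X F (X ^ˢ j) (F ^ˢ j)) n)

  -- h-one and h-tail say that h r = 1 + x (h (r+1) + h 1 (h r - 1)) for r < m.
  module Ladder (m : ℕ) (h : ℕ → Series) (F′ : Series)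
    (h-top : h m ≗ F′)
    (h-one : ∀ r → r < m → h r 0 ≡ 1)
    (h-tail : ∀ r → r < m → tailˢ (h r) ≗ h (suc r) ⊕ (X ⊛ (h 1 ⊛ tailˢ (h r))))
    where

    private
      F = h 0

    F-recursion : 0 < m → F ≗ oneS ⊕ (X ⊛ (h 1 ⊛ F))
    F-recursion 0<m n = trans (constant-one F (h-one 0 0<m) n) (cong (oneS n +_) (⊛-congʳ X tailF≗ n))
      where
      tailF≗ : tailˢ F ≗ h 1 ⊛ F
      tailF≗ n = begin
        tailˢ F n                                  ≡⟨ h-tail 0 0<m n ⟩
        (h 1 ⊕ (X ⊛ (h 1 ⊛ tailˢ F))) n            ≡⟨ cong₂ _+_ (sym (⊛-identityʳ (h 1) n)) (sym (⊛-assoc X (h 1) (tailˢ F) n)) ⟩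
        ((h 1 ⊛ oneS) ⊕ ((X ⊛ h 1) ⊛ tailˢ F)) n   ≡⟨ cong ((h 1 ⊛ oneS) n +_) (trans (⊛-congˡ (tailˢ F) (⊛-comm X (h 1)) n) (⊛-assoc (h 1) X (tailˢ F) n)) ⟩
        ((h 1 ⊛ oneS) ⊕ (h 1 ⊛ (X ⊛ tailˢ F))) n   ≡⟨ ⊛-distribˡ (h 1) oneS (X ⊛ tailˢ F) n ⟨
        (h 1 ⊛ (oneS ⊕ (X ⊛ tailˢ F))) n           ≡⟨ ⊛-congʳ (h 1) (constant-one F (h-one 0 0<m)) n ⟨
        (h 1 ⊛ F) n                                ∎

    rung : ∀ r → r < m → h r ≗ oneS ⊕ (X ⊛ (F ⊛ h (suc r)))
    rung r r<m n = trans (constant-one (h r) (h-one r r<m) n) (cong (oneS n +_) (⊛-congʳ X tail≗ n))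
      where
      D = F ⊛ h (suc r)
      D-recursion : D ≗ h (suc r) ⊕ (X ⊛ (h 1 ⊛ D))
      D-recursion n = begin
        (F ⊛ h (suc r)) n                                          ≡⟨ ⊛-congˡ (h (suc r)) (F-recursion (≤-<-trans z≤n r<m)) n ⟩
        ((oneS ⊕ (X ⊛ (h 1 ⊛ F))) ⊛ h (suc r)) n                   ≡⟨ ⊛-distribʳ oneS (X ⊛ (h 1 ⊛ F)) (h (suc r)) n ⟩
        (oneS ⊛ h (suc r)) n + ((X ⊛ (h 1 ⊛ F)) ⊛ h (suc r)) n     ≡⟨ cong₂ _+_ (⊛-identityˡ (h (suc r)) n)
                                                                        (trans (⊛-assoc X (h 1 ⊛ F) (h (suc r)) n) (⊛-congʳ X (⊛-assoc (h 1) F (h (suc r))) n)) ⟩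
        h (suc r) n + (X ⊛ (h 1 ⊛ D)) n                            ∎
      tail≗ : tailˢ (h r) ≗ D
      tail≗ = X-recursion-unique (h 1) (h (suc r)) (tailˢ (h r)) D (h-tail r r<m) D-recursion

    descend : ∀ j → j ≤ m → h (m ∸ j) ≗ closedForm j F F′
    descend zero _ n = trans (h-top n) (sym (trans (⊛-congˡ F′ (⊛-identityˡ oneS) n) (⊛-identityˡ F′ n)))
    descend (suc j) 1+j≤m n = begin
      h (m ∸ suc j) n                              ≡⟨ rung (m ∸ suc j) r<m n ⟩
      oneS n + (X ⊛ (F ⊛ h (suc (m ∸ suc j)))) n   ≡⟨ cong (oneS n +_) (⊛-congʳ X (⊛-congʳ F upper) n) ⟩
      oneS n + (X ⊛ (F ⊛ closedForm j F F′)) n     ≡⟨ closedForm-suc j F F′ n ⟩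
      closedForm (suc j) F F′ n                    ∎
      where
      r<m : m ∸ suc j < m
      r<m = ∸-monoʳ-< {o = 0} (s≤s z≤n) 1+j≤m
      upper : h (suc (m ∸ suc j)) ≗ closedForm j F F′
      upper = subst (λ q → h q ≗ closedForm j F F′) (+-∸-assoc 1 1+j≤m) (descend j (≤-trans (n≤1+n j) 1+j≤m))

    solution : h 0 ≗ closedForm m (h 0) F′
    solution = subst (λ q → h q ≗ closedForm m F F′) (n∸n≡0 m) (descend m ≤-refl)

open PowerSeries

<⇒<ᵇ≡true : ∀ {m n} → m < n → (m <ᵇ n) ≡ true
<⇒<ᵇ≡true m<n = Equivalence.to T-≡ (<⇒<ᵇ m<n)

<ᵇ≡true⇒< : ∀ {m n} → (m <ᵇ n) ≡ true → m < n
<ᵇ≡true⇒< {m} {n} eq = <ᵇ⇒< m n (Equivalence.from T-≡ eq)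

≮⇒<ᵇ≡false : ∀ {m n} → ¬ m < n → (m <ᵇ n) ≡ false
≮⇒<ᵇ≡false {m} {n} m≮n with m <ᵇ n in eq
... | false = refl
... | true = contradiction (<ᵇ≡true⇒< eq) m≮n

≤⇒≤ᵇ≡true : ∀ {m n} → m ≤ n → (m ≤ᵇ n) ≡ true
≤⇒≤ᵇ≡true m≤n = Equivalence.to T-≡ (≤⇒≤ᵇ m≤n)

>⇒≤ᵇ≡false : ∀ {m n} → n < m → (m ≤ᵇ n) ≡ false
>⇒≤ᵇ≡false {m} {n} n<m with m ≤ᵇ n in eq
... | false = refl
... | true = contradiction (≤ᵇ⇒≤ m n (Equivalence.from T-≡ eq)) (<⇒≱ n<m)

∧-≡true : ∀ {a b} → a ≡ true → b ≡ true → (a ∧ b) ≡ true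
∧-≡true refl refl = refl

==⇒≡ : ∀ {a b} → (a == b) ≡ true → a ≡ b
==⇒≡ {true} {true} _ = refl
==⇒≡ {false} {false} _ = refl

and-++ : ∀ l₁ l₂ → and (l₁ ++ l₂) ≡ (and l₁ ∧ and l₂)
and-++ [] l₂ = refl
and-++ (b ∷ l₁) l₂ rewrite and-++ l₁ l₂ = sym (∧-assoc b (and l₁) (and l₂))

zipWith-++ : ∀ (f : ℕ → ℕ → Bool) xs ys s t → length xs ≡ length ys →
  zipWith f (xs ++ s) (ys ++ t) ≡ zipWith f xs ys ++ zipWith f s t
zipWith-++ f [] [] s t _ = refl
zipWith-++ f (x ∷ xs) (y ∷ ys) s t eq = cong (f x y ∷_) (zipWith-++ f xs ys s t (suc-injective eq))

and-zipWith⁻ : ∀ (P : ℕ → ℕ → Bool) xs ys → length xs ≡ length ys → and (zipWith P xs ys) ≡ true →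
  ∀ {b} → b ∈ ys → Σ ℕ λ a → a ∈ xs × P a b ≡ true
and-zipWith⁻ P (x ∷ xs) (y ∷ ys) _ h (here refl) = x , here refl , ∧-conicalˡ (P x y) _ h
and-zipWith⁻ P (x ∷ xs) (y ∷ ys) eq h (there b∈) with and-zipWith⁻ P xs ys (suc-injective eq) (∧-conicalʳ (P x y) _ h) b∈
... | a , a∈ , Pab = a , there a∈ , Pab

and-zipWith⁺ : ∀ (P : ℕ → ℕ → Bool) xs ys → (∀ {a b} → a ∈ xs → b ∈ ys → P a b ≡ true) → and (zipWith P xs ys) ≡ true
and-zipWith⁺ P [] ys _ = refl
and-zipWith⁺ P (x ∷ xs) [] _ = refl
and-zipWith⁺ P (x ∷ xs) (y ∷ ys) P⁺ = ∧-≡true (P⁺ (here refl) (here refl)) (and-zipWith⁺ P xs ys (λ a∈ b∈ → P⁺ (there a∈) (there b∈)))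

sameAbove sameBelow : ℕ → ℕ → ℕ → ℕ → Bool
sameAbove x y x′ y′ = (x <ᵇ x′) == (y <ᵇ y′)
sameBelow x y x′ y′ = (x′ <ᵇ x) == (y′ <ᵇ y)

crossIso : List ℕ → List ℕ → List ℕ → List ℕ → Bool
crossIso (x ∷ xs) (y ∷ ys) s′ t′ =
  (and (zipWith (sameAbove x y) s′ t′) ∧ and (zipWith (sameBelow x y) s′ t′)) ∧ crossIso xs ys s′ t′
crossIso _ _ _ _ = true

private
  ∧-shuffle : ∀ a₁ a₂ b₁ b₂ i c o →
    ((a₁ ∧ a₂) ∧ ((b₁ ∧ b₂) ∧ ((i ∧ c) ∧ o))) ≡ (((a₁ ∧ (b₁ ∧ i)) ∧ ((a₂ ∧ b₂) ∧ c)) ∧ o)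
  ∧-shuffle false _ _ _ _ _ _ = refl
  ∧-shuffle true a₂ false _ _ _ _ = ∧-zeroʳ a₂
  ∧-shuffle true a₂ true b₂ false _ _ = trans (cong (a₂ ∧_) (∧-zeroʳ b₂)) (∧-zeroʳ a₂)
  ∧-shuffle true a₂ true b₂ true c o = sym (trans (∧-assoc (a₂ ∧ b₂) c o) (∧-assoc a₂ b₂ (c ∧ o)))

ordIso-++ : ∀ s t s′ t′ → length s ≡ length t →
  ordIso (s ++ s′) (t ++ t′) ≡ ((ordIso s t ∧ crossIso s t s′ t′) ∧ ordIso s′ t′)
ordIso-++ [] [] s′ t′ _ = refl
ordIso-++ (x ∷ xs) (y ∷ ys) s′ t′ eq
  rewrite zipWith-++ (sameAbove x y) xs ys s′ t′ (suc-injective eq) | zipWith-++ (sameBelow x y) xs ys s′ t′ (suc-injective eq)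
        | and-++ (zipWith (sameAbove x y) xs ys) (zipWith (sameAbove x y) s′ t′)
        | and-++ (zipWith (sameBelow x y) xs ys) (zipWith (sameBelow x y) s′ t′)
        | ordIso-++ xs ys s′ t′ (suc-injective eq)
  = ∧-shuffle (and (zipWith (sameAbove x y) xs ys)) (and (zipWith (sameAbove x y) s′ t′))
              (and (zipWith (sameBelow x y) xs ys)) (and (zipWith (sameBelow x y) s′ t′))
              (ordIso xs ys) (crossIso xs ys s′ t′) (ordIso s′ t′)

ordIso-++⁻ : ∀ s t s′ t′ → length s ≡ length t → ordIso (s ++ s′) (t ++ t′) ≡ true →
  ordIso s t ≡ true × crossIso s t s′ t′ ≡ true × ordIso s′ t′ ≡ true
ordIso-++⁻ s t s′ t′ eq iso =
  ∧-conicalˡ _ _ front , ∧-conicalʳ _ _ front , ∧-conicalʳ _ _ iso′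
  where
  iso′ = trans (sym (ordIso-++ s t s′ t′ eq)) iso
  front = ∧-conicalˡ _ _ iso′

ordIso-++⁺ : ∀ s t s′ t′ → length s ≡ length t →
  ordIso s t ≡ true → crossIso s t s′ t′ ≡ true → ordIso s′ t′ ≡ true → ordIso (s ++ s′) (t ++ t′) ≡ true
ordIso-++⁺ s t s′ t′ eq iso cross iso′ = trans (ordIso-++ s t s′ t′ eq) (∧-≡true (∧-≡true iso cross) iso′)

crossIso⇒< : ∀ s t s′ t′ → length s ≡ length t → length s′ ≡ length t′ → (∀ {x x′} → x ∈ s → x′ ∈ s′ → x < x′) →
  crossIso s t s′ t′ ≡ true → ∀ {y y′} → y ∈ t → y′ ∈ t′ → y < y′
crossIso⇒< (x ∷ s) (y ∷ t) s′ t′ _ eq′ s<s′ cross (here refl) y′∈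
  with and-zipWith⁻ (sameAbove x y) s′ t′ eq′ (∧-conicalˡ _ _ (∧-conicalˡ _ _ cross)) y′∈
... | x′ , x′∈ , same = <ᵇ≡true⇒< (trans (sym (==⇒≡ same)) (<⇒<ᵇ≡true (s<s′ (here refl) x′∈)))
crossIso⇒< (x ∷ s) (y ∷ t) s′ t′ eq eq′ s<s′ cross (there y∈) y′∈ =
  crossIso⇒< s t s′ t′ (suc-injective eq) eq′ (λ x∈ → s<s′ (there x∈)) (∧-conicalʳ _ _ cross) y∈ y′∈

<⇒crossIso : ∀ s t s′ t′ → (∀ {x x′} → x ∈ s → x′ ∈ s′ → x < x′) → (∀ {y y′} → y ∈ t → y′ ∈ t′ → y < y′) →
  crossIso s t s′ t′ ≡ true
<⇒crossIso [] t s′ t′ _ _ = refl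
<⇒crossIso (x ∷ s) [] s′ t′ _ _ = refl
<⇒crossIso (x ∷ s) (y ∷ t) s′ t′ s<s′ t<t′ =
  ∧-≡true (∧-≡true (and-zipWith⁺ (sameAbove x y) s′ t′ above) (and-zipWith⁺ (sameBelow x y) s′ t′ below))
          (<⇒crossIso s t s′ t′ (λ x∈ → s<s′ (there x∈)) (λ y∈ → t<t′ (there y∈)))
  where
  above : ∀ {x′ y′} → x′ ∈ s′ → y′ ∈ t′ → sameAbove x y x′ y′ ≡ true
  above x′∈ y′∈ rewrite <⇒<ᵇ≡true (s<s′ (here refl) x′∈) | <⇒<ᵇ≡true (t<t′ (here refl) y′∈) = refl
  below : ∀ {x′ y′} → x′ ∈ s′ → y′ ∈ t′ → sameBelow x y x′ y′ ≡ true
  below x′∈ y′∈ rewrite ≮⇒<ᵇ≡false (<-asym (s<s′ (here refl) x′∈)) | ≮⇒<ᵇ≡false (<-asym (t<t′ (here refl) y′∈)) = refl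

Linked-head : ∀ {x l} → Linked _<_ (x ∷ l) → All (x <_) l
Linked-head inc with Linked⇒AllPairs <-trans inc
... | x<l ∷ _ = x<l

Linked-middle : ∀ e {a b l} → Linked _<_ (e ++ a ∷ b ∷ l) → a < b
Linked-middle [] (a<b ∷ _) = a<b
Linked-middle (x ∷ []) (_ ∷ inc) = Linked-middle [] inc
Linked-middle (x ∷ y ∷ e) (_ ∷ inc) = Linked-middle (y ∷ e) inc

ordIso-∷⁻ : ∀ x y s t → ordIso (x ∷ s) (y ∷ t) ≡ true →
  and (zipWith (sameAbove x y) s t) ≡ true × and (zipWith (sameBelow x y) s t) ≡ true × ordIso s t ≡ true
ordIso-∷⁻ x y s t iso =
  ∧-conicalˡ (and (zipWith (sameAbove x y) s t)) _ iso ,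
  ∧-conicalˡ (and (zipWith (sameBelow x y) s t)) _ rest ,
  ∧-conicalʳ (and (zipWith (sameBelow x y) s t)) _ rest
  where
  rest = ∧-conicalʳ (and (zipWith (sameAbove x y) s t)) _ iso

ordIso-Linked : ∀ s t → Linked _<_ s → ordIso s t ≡ true → Linked _<_ t
ordIso-Linked [] [] _ _ = []
ordIso-Linked (x ∷ []) (y ∷ []) _ _ = [-]
ordIso-Linked (x ∷ x₂ ∷ s) (y ∷ y₂ ∷ t) (x<x₂ ∷ inc) iso with ordIso-∷⁻ x y (x₂ ∷ s) (y₂ ∷ t) iso
... | above , _ , iso′ =
  <ᵇ≡true⇒< (trans (sym (==⇒≡ (∧-conicalˡ (sameAbove x y x₂ y₂) _ above))) (<⇒<ᵇ≡true x<x₂))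
  ∷ ordIso-Linked (x₂ ∷ s) (y₂ ∷ t) inc iso′

Linked⇒ordIso : ∀ s t → Linked _<_ s → Linked _<_ t → length s ≡ length t → ordIso s t ≡ true
Linked⇒ordIso [] [] _ _ _ = refl
Linked⇒ordIso (x ∷ s) (y ∷ t) incs inct eq =
  ∧-≡true (and-zipWith⁺ (sameAbove x y) s t above)
    (∧-≡true (and-zipWith⁺ (sameBelow x y) s t below) (Linked⇒ordIso s t (Linked.tail incs) (Linked.tail inct) (suc-injective eq)))
  where
  above : ∀ {x′ y′} → x′ ∈ s → y′ ∈ t → sameAbove x y x′ y′ ≡ true
  above x′∈ y′∈ rewrite <⇒<ᵇ≡true (All.lookup (Linked-head incs) x′∈) | <⇒<ᵇ≡true (All.lookup (Linked-head inct) y′∈) = refl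
  below : ∀ {x′ y′} → x′ ∈ s → y′ ∈ t → sameBelow x y x′ y′ ≡ true
  below x′∈ y′∈ rewrite ≮⇒<ᵇ≡false (<-asym (All.lookup (Linked-head incs) x′∈))
                      | ≮⇒<ᵇ≡false (<-asym (All.lookup (Linked-head inct) y′∈)) = refl

ordIso-132⇒ : ∀ x y z → ordIso (1 ∷ 3 ∷ 2 ∷ []) (x ∷ y ∷ z ∷ []) ≡ true → x < z × z < y
ordIso-132⇒ x y z iso with ordIso-∷⁻ 1 x (3 ∷ 2 ∷ []) (y ∷ z ∷ []) iso
... | above , _ , iso′ with ordIso-∷⁻ 3 y (2 ∷ []) (z ∷ []) iso′
...   | _ , below , _ =
  <ᵇ≡true⇒< (∧-conicalˡ (x <ᵇ z) true (∧-conicalʳ (x <ᵇ y) _ above)) ,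
  <ᵇ≡true⇒< (∧-conicalˡ (z <ᵇ y) true below)

ordIso-132⇐ : ∀ x y z → x < z → z < y → ordIso (1 ∷ 3 ∷ 2 ∷ []) (x ∷ y ∷ z ∷ []) ≡ true
ordIso-132⇐ x y z x<z z<y
  rewrite <⇒<ᵇ≡true (<-trans x<z z<y) | <⇒<ᵇ≡true x<z | <⇒<ᵇ≡true z<y
        | ≮⇒<ᵇ≡false (<-asym (<-trans x<z z<y)) | ≮⇒<ᵇ≡false (<-asym x<z) | ≮⇒<ᵇ≡false (<-asym z<y) = refl

OrderPreserving : (ℕ → ℕ) → Set
OrderPreserving g = ∀ x y → (g x <ᵇ g y) ≡ (x <ᵇ y)

ordIso-map : ∀ g → OrderPreserving g → ∀ s t → ordIso s (map g t) ≡ ordIso s t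
ordIso-map g g-pres [] [] = refl
ordIso-map g g-pres [] (y ∷ t) = refl
ordIso-map g g-pres (x ∷ s) [] = refl
ordIso-map g g-pres (x ∷ s) (y ∷ t) =
  cong₂ _∧_ (cong and (trans (zipWith-mapʳ _ g s t) (zipWith-cong (λ a b → cong ((x <ᵇ a) ==_) (g-pres y b)) s t)))
    (cong₂ _∧_ (cong and (trans (zipWith-mapʳ _ g s t) (zipWith-cong (λ a b → cong ((a <ᵇ x) ==_) (g-pres b y)) s t)))
      (ordIso-map g g-pres s t))
  where
  zipWith-mapʳ : ∀ (f : ℕ → ℕ → Bool) (g : ℕ → ℕ) xs ys → zipWith f xs (map g ys) ≡ zipWith (λ a b → f a (g b)) xs ys
  zipWith-mapʳ f g [] ys = refl
  zipWith-mapʳ f g (x ∷ xs) [] = refl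
  zipWith-mapʳ f g (x ∷ xs) (y ∷ ys) = cong (f x (g y) ∷_) (zipWith-mapʳ f g xs ys)

strictlyIncreasing⇒OrderPreserving : ∀ g → (∀ {x y} → x < y → g x < g y) → OrderPreserving g
strictlyIncreasing⇒OrderPreserving g g-< x y with <-cmp x y
... | tri< x<y _ _ = trans (<⇒<ᵇ≡true (g-< x<y)) (sym (<⇒<ᵇ≡true x<y))
... | tri≈ _ refl _ = trans (≮⇒<ᵇ≡false {g x} {g x} (<-irrefl refl)) (sym (≮⇒<ᵇ≡false {x} {x} (<-irrefl refl)))
... | tri> _ _ y<x = trans (≮⇒<ᵇ≡false (<-asym (g-< y<x))) (sym (≮⇒<ᵇ≡false (<-asym y<x)))

data Factors : GPat → List ℕ → List ℕ → Set where
  done : ∀ {π} → Factors [] π []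
  skip : ∀ {b bs x π w} → Factors (b ∷ bs) π w → Factors (b ∷ bs) (x ∷ π) w
  factor : ∀ {b bs x v ρ w} → length (x ∷ v) ≡ length b → Factors bs ρ w → Factors (b ∷ bs) (x ∷ v ++ ρ) (x ∷ v ++ w)

NonEmptyBlocks : GPat → Set
NonEmptyBlocks τ = All (λ b → b ≢ []) τ

take-length-++ : ∀ (xs ys : List ℕ) → take (length xs) (xs ++ ys) ≡ xs
take-length-++ [] ys = refl
take-length-++ (x ∷ xs) ys = cong (x ∷_) (take-length-++ xs ys)

drop-length-++ : ∀ (xs ys : List ℕ) → drop (length xs) (xs ++ ys) ≡ ys
drop-length-++ [] ys = refl
drop-length-++ (x ∷ xs) ys = drop-length-++ xs ys

Factors⇒∈occs : ∀ {τ π w} → Factors τ π w → w ∈ occs τ π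
Factors⇒∈occs done = here refl
Factors⇒∈occs (skip fs) = ∈-++⁺ʳ _ (Factors⇒∈occs fs)
Factors⇒∈occs {b ∷ bs} (factor {x = x} {v} {ρ} {w} len fs) rewrite sym len = leading
  where
  leading : (x ∷ v ++ w) ∈ ((if length (x ∷ v) ≤ᵇ length (x ∷ v ++ ρ)
    then map (take (length (x ∷ v)) (x ∷ v ++ ρ) ++_) (occs bs (drop (length (x ∷ v)) (x ∷ v ++ ρ))) else [])
    ++ occs (b ∷ bs) (v ++ ρ))
  leading rewrite ≤⇒≤ᵇ≡true (s≤s (length-++-≤ˡ v {ρ})) | take-length-++ v ρ | drop-length-++ v ρ =
    ∈-++⁺ˡ (∈-map⁺ ((x ∷ v) ++_) (Factors⇒∈occs fs))

∈-if⁻ : ∀ {A : Set} {x : A} c xs → x ∈ (if c then xs else []) → c ≡ true × x ∈ xs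
∈-if⁻ true xs x∈ = refl , x∈

∈occs⇒Factors : ∀ τ π {w} → NonEmptyBlocks τ → w ∈ occs τ π → Factors τ π w
∈occs⇒Factors [] π _ (here refl) = done
∈occs⇒Factors ([] ∷ bs) (x ∷ π) ([]≢[] ∷ _) _ = ⊥-elim ([]≢[] refl)
∈occs⇒Factors ((y ∷ b) ∷ bs) (x ∷ π) ne@(_ ∷ ne′) w∈ =
  [ leading , (λ w∈later → skip (∈occs⇒Factors ((y ∷ b) ∷ bs) π ne w∈later)) ]′ (∈-++⁻ _ w∈)
  where
  lead = x ∷ take (length b) π
  leading : ∀ {w} → w ∈ (if length b <ᵇ suc (length π) then map (lead ++_) (occs bs (drop (length b) π)) else []) →
    Factors ((y ∷ b) ∷ bs) (x ∷ π) w
  leading w∈lead with ∈-if⁻ (length b <ᵇ suc (length π)) _ w∈lead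
  ... | fits , w∈here with ∈-map⁻ (lead ++_) w∈here
  ...   | w′ , w′∈ , refl =
    subst (λ ρ → Factors ((y ∷ b) ∷ bs) (x ∷ ρ) (lead ++ w′)) (take++drop≡id (length b) π)
      (factor (cong suc (trans (length-take (length b) π) (m≤n⇒m⊓n≡m (≤-pred (<ᵇ≡true⇒< fits)))))
              (∈occs⇒Factors bs (drop (length b) π) ne′ w′∈))

Contains : GPat → List ℕ → Set
Contains τ π = Σ (List ℕ) λ w → Factors τ π w × ordIso (concat τ) w ≡ true

contains⇒Contains : ∀ τ π → NonEmptyBlocks τ → contains τ π ≡ true → Contains τ π
contains⇒Contains τ π ne c with find (any⁻ (ordIso (concat τ)) (occs τ π) (Equivalence.from T-≡ c))
... | w , w∈ , iso = w , ∈occs⇒Factors τ π ne w∈ , Equivalence.to T-≡ iso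

Contains⇒contains : ∀ τ π → Contains τ π → contains τ π ≡ true
Contains⇒contains τ π (w , fs , iso) =
  Equivalence.to T-≡ (any⁺ (ordIso (concat τ)) (lose (Factors⇒∈occs fs) (Equivalence.from T-≡ iso)))

occs-map : ∀ g τ π → occs τ (map g π) ≡ map (map g) (occs τ π)
occs-map g [] π = refl
occs-map g (b ∷ bs) [] = refl
-- The induction hypotheses are passed to a helper so that its rewrites do not hide the
-- recursive calls from the termination checker.
occs-map g (b ∷ bs) (x ∷ π) = unfold (occs-map g bs (drop (length b) (x ∷ π))) (occs-map g (b ∷ bs) π)
  where
  t = take (length b) (x ∷ π)
  d = drop (length b) (x ∷ π)
  unfold : occs bs (map g d) ≡ map (map g) (occs bs d) → occs (b ∷ bs) (map g π) ≡ map (map g) (occs (b ∷ bs) π) →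
    occs (b ∷ bs) (map g (x ∷ π)) ≡ map (map g) (occs (b ∷ bs) (x ∷ π))
  unfold ih₁ ih₂ rewrite length-map g π | take-map {f = g} (length b) (x ∷ π) | drop-map {f = g} (length b) (x ∷ π) | ih₁ | ih₂
    with length b ≤ᵇ suc (length π)
  ... | false = refl
  ... | true = sym (trans (map-++ (map g) (map (t ++_) (occs bs d)) _) (cong (_++ map (map g) (occs (b ∷ bs) π)) lead))
    where
    lead : map (map g) (map (t ++_) (occs bs d)) ≡ map (map g t ++_) (map (map g) (occs bs d))
    lead = trans (sym (map-∘ (occs bs d))) (trans (map-cong (map-++ g t) (occs bs d)) (map-∘ (occs bs d)))

contains-map : ∀ g → OrderPreserving g → ∀ τ π → contains τ (map g π) ≡ contains τ π
contains-map g g-pres τ π = begin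
  any (ordIso (concat τ)) (occs τ (map g π))           ≡⟨ cong (any (ordIso (concat τ))) (occs-map g τ π) ⟩
  any (ordIso (concat τ)) (map (map g) (occs τ π))      ≡⟨ any-map (occs τ π) ⟩
  any (ordIso (concat τ)) (occs τ π)                   ∎
  where
  open ≡-Reasoning
  any-map : ∀ L → any (ordIso (concat τ)) (map (map g) L) ≡ any (ordIso (concat τ)) L
  any-map [] = refl
  any-map (w ∷ L) = cong₂ _∨_ (ordIso-map g g-pres (concat τ) w) (any-map L)

Factors-++ʳ : ∀ {τ p w} → Factors τ p w → ∀ q → Factors τ (p ++ q) w
Factors-++ʳ done q = done
Factors-++ʳ (skip fs) q = skip (Factors-++ʳ fs q)
Factors-++ʳ (factor {b} {bs} {x} {v} {ρ} {w} len fs) q =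
  subst (λ z → Factors (b ∷ bs) (x ∷ z) (x ∷ v ++ w)) (sym (++-assoc v ρ q)) (factor len (Factors-++ʳ fs q))

Factors-++ˡ : ∀ {τ p w} u → Factors τ p w → Factors τ (u ++ p) w
Factors-++ˡ [] fs = fs
Factors-++ˡ (y ∷ u) done = done
Factors-++ˡ (y ∷ u) fs@(skip _) = skip (Factors-++ˡ u fs)
Factors-++ˡ (y ∷ u) fs@(factor _ _) = skip (Factors-++ˡ u fs)

Contains-++ʳ : ∀ τ p q → Contains τ p → Contains τ (p ++ q)
Contains-++ʳ τ p q (w , fs , iso) = w , Factors-++ʳ fs q , iso

Contains-++ˡ : ∀ τ u p → Contains τ p → Contains τ (u ++ p)
Contains-++ˡ τ u p (w , fs , iso) = w , Factors-++ˡ u fs , iso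

Factors-length : ∀ {τ π w} → Factors τ π w → length w ≡ length (concat τ)
Factors-length done = refl
Factors-length (skip fs) = Factors-length fs
Factors-length (factor {b} {bs} {x} {v} {ρ} {w} len fs) =
  trans (length-++ (x ∷ v) {w}) (trans (cong₂ _+_ len (Factors-length fs)) (sym (length-++ b {concat bs})))

Factors-⊆ : ∀ {τ π w} → Factors τ π w → ∀ {z} → z ∈ w → z ∈ π
Factors-⊆ (skip fs) z∈ = there (Factors-⊆ fs z∈)
Factors-⊆ (factor _ _) (here z≡x) = here z≡x
Factors-⊆ (factor {v = v} _ fs) (there z∈) with ∈-++⁻ v z∈
... | inj₁ z∈v = there (∈-++⁺ˡ z∈v)
... | inj₂ z∈w = there (∈-++⁺ʳ v (Factors-⊆ fs z∈w))

record Split (τ₁ τ₂ : GPat) (π w : List ℕ) : Set where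
  constructor split
  field
    p s w₁ w₂ : List ℕ
    π≡ : π ≡ p ++ s
    w≡ : w ≡ w₁ ++ w₂
    factors₁ : Factors τ₁ p w₁
    factors₂ : Factors τ₂ s w₂

Factors-split : ∀ τ₁ τ₂ {π w} → Factors (τ₁ ++ τ₂) π w → Split τ₁ τ₂ π w
Factors-split [] τ₂ {π} {w} fs = split [] π [] w refl refl done fs
Factors-split (b ∷ τ₁) τ₂ (skip {x = x} fs) with Factors-split (b ∷ τ₁) τ₂ fs
... | split p s w₁ w₂ refl refl fs₁ fs₂ = split (x ∷ p) s w₁ w₂ refl refl (skip fs₁) fs₂
Factors-split (b ∷ τ₁) τ₂ (factor {x = x} {v} len fs) with Factors-split τ₁ τ₂ fs
... | split p s w₁ w₂ refl refl fs₁ fs₂ =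
  split (x ∷ v ++ p) s (x ∷ v ++ w₁) w₂ (cong (x ∷_) (sym (++-assoc v p s))) (cong (x ∷_) (sym (++-assoc v w₁ w₂))) (factor len fs₁) fs₂

Factors-join : ∀ {τ₁ τ₂ p s w₁ w₂} → Factors τ₁ p w₁ → Factors τ₂ s w₂ → Factors (τ₁ ++ τ₂) (p ++ s) (w₁ ++ w₂)
Factors-join {p = p} done fs₂ = Factors-++ˡ p fs₂
Factors-join (skip fs₁) fs₂ = skip (Factors-join fs₁ fs₂)
Factors-join {s = s} {w₂ = w₂} (factor {b} {bs} {x} {v} {ρ} {w} len fs₁) fs₂ =
  subst₂ (λ z z′ → Factors (b ∷ (bs ++ _)) (x ∷ z) (x ∷ z′)) (sym (++-assoc v ρ s)) (sym (++-assoc v w w₂))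
    (factor {v = v} len (Factors-join fs₁ fs₂))

record Factor (b s w : List ℕ) : Set where
  constructor factorOf
  field
    before after : List ℕ
    s≡ : s ≡ before ++ w ++ after
    length≡ : length w ≡ length b

Factors-single : ∀ {b s w} → Factors (b ∷ []) s w → Factor b s w
Factors-single (skip {x = x} fs) with Factors-single fs
... | factorOf u t refl len = factorOf (x ∷ u) t refl len
Factors-single (factor {x = x} {v} {ρ} len done) =
  factorOf [] ρ (cong (λ z → x ∷ z ++ ρ) (sym (++-identityʳ v))) (trans (cong (λ z → length (x ∷ z)) (++-identityʳ v)) len)

Factors-dropPrefix : ∀ {τ L w} A e → Factors τ L w → L ≡ A ++ e → (Σ ℕ λ z → z ∈ w × z ∈ A) ⊎ Factors τ e w
Factors-dropPrefix [] e fs refl = inj₂ fs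
Factors-dropPrefix (a ∷ A) e done _ = inj₂ done
Factors-dropPrefix (a ∷ A) e (skip fs) refl with Factors-dropPrefix A e fs refl
... | inj₁ (z , z∈w , z∈A) = inj₁ (z , z∈w , there z∈A)
... | inj₂ fs′ = inj₂ fs′
Factors-dropPrefix (a ∷ A) e (factor {x = x} _ _) L≡ = inj₁ (x , here refl , here (∷-injectiveˡ L≡))

SingletonBlocks : GPat → Set
SingletonBlocks τ = All (λ b → length b ≡ 1) τ

record SplitAt (τ : GPat) (X Y w : List ℕ) : Set where
  constructor splitAt
  field
    τ₁ τ₂ : GPat
    w₁ w₂ : List ℕ
    τ≡ : τ ≡ τ₁ ++ τ₂
    w≡ : w ≡ w₁ ++ w₂
    factors₁ : Factors τ₁ X w₁
    factors₂ : Factors τ₂ Y w₂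

-- For a classical pattern any cut of π cuts the pattern between two letters.
Factors-splitAt : ∀ {τ L w} → SingletonBlocks τ → ∀ X Y → Factors τ L w → L ≡ X ++ Y → SplitAt τ X Y w
Factors-splitAt {τ} {w = w} _ [] Y fs refl = splitAt [] τ [] w refl refl done fs
Factors-splitAt _ (a ∷ X) Y done _ = splitAt [] [] [] [] refl refl done done
Factors-splitAt sb (a ∷ X) Y (skip fs) refl with Factors-splitAt sb X Y fs refl
... | splitAt τ₁ τ₂ w₁ w₂ τ≡ w≡ fs₁ fs₂ = splitAt τ₁ τ₂ w₁ w₂ τ≡ w≡ (Factors-++ˡ (a ∷ []) fs₁) fs₂
Factors-splitAt (_ ∷ sb) (a ∷ X) Y (factor {b} {v = []} len fs) refl with Factors-splitAt sb X Y fs refl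
... | splitAt τ₁ τ₂ w₁ w₂ refl refl fs₁ fs₂ = splitAt (b ∷ τ₁) τ₂ (a ∷ w₁) w₂ refl refl (factor len fs₁) fs₂
Factors-splitAt (len₁ ∷ _) (a ∷ X) Y (factor {v = _ ∷ _} len _) _ = ⊥-elim (1+n≢0 (suc-injective (trans len len₁)))

++-split : ∀ (P X A Y : List ℕ) → P ++ X ≡ A ++ Y →
  (Σ (List ℕ) λ e → P ≡ A ++ e × Y ≡ e ++ X) ⊎ (Σ (List ℕ) λ e → e ≢ [] × A ≡ P ++ e × X ≡ e ++ Y)
++-split [] X [] Y eq = inj₁ ([] , refl , sym eq)
++-split [] X (a ∷ A) Y eq = inj₂ (a ∷ A , (λ ()) , refl , eq)
++-split (p ∷ P) X [] Y eq = inj₁ (p ∷ P , refl , sym eq)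
++-split (p ∷ P) X (a ∷ A) Y eq with ∷-injective eq
... | refl , eq′ with ++-split P X A Y eq′
...   | inj₁ (e , P≡ , Y≡) = inj₁ (e , cong (p ∷_) P≡ , Y≡)
...   | inj₂ (e , e≢[] , A≡ , X≡) = inj₂ (e , e≢[] , cong (p ∷_) A≡ , X≡)

∷ʳ-suffix : ∀ (A : List ℕ) n P e → e ≢ [] → A ++ [ n ] ≡ P ++ e → Σ (List ℕ) λ e′ → e ≡ e′ ++ [ n ]
∷ʳ-suffix A n [] e _ eq = A , sym eq
∷ʳ-suffix [] n (p ∷ []) e e≢[] eq = ⊥-elim (e≢[] (sym (∷-injectiveʳ eq)))
∷ʳ-suffix [] n (p ∷ q ∷ P) e _ ()
∷ʳ-suffix (a ∷ A) n (p ∷ P) e e≢[] eq = ∷ʳ-suffix A n P e e≢[] (∷-injectiveʳ eq)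

avoids⇒¬Contains : ∀ τ π → avoids τ π ≡ true → ¬ Contains τ π
avoids⇒¬Contains τ π av c with contains τ π | Contains⇒contains τ π c
avoids⇒¬Contains τ π () c | .true | refl

¬Contains⇒avoids : ∀ τ π → NonEmptyBlocks τ → ¬ Contains τ π → avoids τ π ≡ true
¬Contains⇒avoids τ π ne ¬c with contains τ π in eq
... | false = refl
... | true = ⊥-elim (¬c (contains⇒Contains τ π ne eq))

Contains⇒avoids≡false : ∀ τ π → Contains τ π → avoids τ π ≡ false
Contains⇒avoids≡false τ π c rewrite Contains⇒contains τ π c = refl

avoids≡false⇒Contains : ∀ τ π → NonEmptyBlocks τ → avoids τ π ≡ false → Contains τ π
avoids≡false⇒Contains τ π ne av with contains τ π in eq
avoids≡false⇒Contains τ π ne refl | true = contains⇒Contains τ π ne eq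

avoids-cong : ∀ τ π τ′ π′ → NonEmptyBlocks τ → NonEmptyBlocks τ′ →
  (Contains τ π → Contains τ′ π′) → (Contains τ′ π′ → Contains τ π) → avoids τ π ≡ avoids τ′ π′
avoids-cong τ π τ′ π′ ne ne′ to from with avoids τ′ π′ in e′
... | false = Contains⇒avoids≡false τ π (from (avoids≡false⇒Contains τ′ π′ ne′ e′))
... | true = ¬Contains⇒avoids τ π ne (avoids⇒¬Contains τ′ π′ e′ ∘ to)

avoids-++ : ∀ τ X Y → NonEmptyBlocks τ → (Contains τ (X ++ Y) → Contains τ X ⊎ Contains τ Y) →
  avoids τ (X ++ Y) ≡ (avoids τ X ∧ avoids τ Y)
avoids-++ τ X Y ne splits with avoids τ X in eX | avoids τ Y in eY
... | false | _ = Contains⇒avoids≡false τ (X ++ Y) (Contains-++ʳ τ X Y (avoids≡false⇒Contains τ X ne eX))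
... | true | false = Contains⇒avoids≡false τ (X ++ Y) (Contains-++ˡ τ X Y (avoids≡false⇒Contains τ Y ne eY))
... | true | true = ¬Contains⇒avoids τ (X ++ Y) ne ([ avoids⇒¬Contains τ X eX , avoids⇒¬Contains τ Y eY ]′ ∘ splits)

range1-suc : ∀ n → range1 (suc n) ≡ range1 n ++ [ suc n ]
range1-suc n = trans (cong (map suc) (sym (upTo-∷ʳ n))) (map-++ suc (upTo n) [ n ])

range1-↭ : ∀ n → range1 (suc n) ↭ suc n ∷ range1 n
range1-↭ n = subst (_↭ suc n ∷ range1 n) (sym (range1-suc n)) (↭-sym (∷↭∷ʳ (suc n) (range1 n)))

∈-range1⁻ : ∀ {n x} → x ∈ range1 n → 1 ≤ x × x ≤ n
∈-range1⁻ x∈ with ∈-map⁻ suc x∈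
... | i , i∈ , refl = s≤s z≤n , ∈-upTo⁻ i∈

∈-range1⁺ : ∀ {n x} → 1 ≤ x → x ≤ n → x ∈ range1 n
∈-range1⁺ {x = suc i} (s≤s _) x≤n = ∈-map⁺ suc (∈-upTo⁺ x≤n)

length-range1 : ∀ n → length (range1 n) ≡ n
length-range1 n = trans (length-map suc (upTo n)) (length-upTo n)

range1-unique : ∀ n → Unique (range1 n)
range1-unique n = Unique.map⁺ suc-injective (Unique.upTo⁺ n)

↭range1-unique : ∀ {π n} → π ↭ range1 n → Unique π
↭range1-unique {n = n} π↭ = Unique-resp-↭ (↭⇒↭ₛ (↭-sym π↭)) (range1-unique n)

range1-+ : ∀ t s → range1 (t + s) ≡ range1 t ++ map (t +_) (range1 s)
range1-+ t zero = trans (cong range1 (+-identityʳ t)) (sym (++-identityʳ (range1 t)))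
range1-+ t (suc s) = begin
  range1 (t + suc s)                                    ≡⟨ cong range1 (+-suc t s) ⟩
  range1 (suc (t + s))                                  ≡⟨ range1-suc (t + s) ⟩
  range1 (t + s) ++ [ suc (t + s) ]                     ≡⟨ cong (_++ [ suc (t + s) ]) (range1-+ t s) ⟩
  (range1 t ++ map (t +_) (range1 s)) ++ [ suc (t + s) ] ≡⟨ ++-assoc (range1 t) _ _ ⟩
  range1 t ++ (map (t +_) (range1 s) ++ [ suc (t + s) ]) ≡⟨ cong (λ z → range1 t ++ (map (t +_) (range1 s) ++ [ z ])) (sym (+-suc t s)) ⟩
  range1 t ++ (map (t +_) (range1 s) ++ map (t +_) [ suc s ]) ≡⟨ cong (range1 t ++_) (map-++ (t +_) (range1 s) [ suc s ]) ⟨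
  range1 t ++ map (t +_) (range1 s ++ [ suc s ])        ≡⟨ cong (λ z → range1 t ++ map (t +_) z) (range1-suc s) ⟨
  range1 t ++ map (t +_) (range1 (suc s))               ∎
  where open ≡-Reasoning

∈-insertions : ∀ x (a b : List ℕ) → (a ++ x ∷ b) ∈ insertions x (a ++ b)
∈-insertions x [] [] = here refl
∈-insertions x [] (y ∷ b) = here refl
∈-insertions x (y ∷ a) b = there (∈-map⁺ (y ∷_) (∈-insertions x a b))

insertions-↭ : ∀ x ys {z} → z ∈ insertions x ys → z ↭ x ∷ ys
insertions-↭ x [] (here refl) = ↭-refl
insertions-↭ x (y ∷ ys) (here refl) = ↭-refl
insertions-↭ x (y ∷ ys) (there z∈) with ∈-map⁻ (y ∷_) z∈
... | z′ , z′∈ , refl = ↭-trans (prep y (insertions-↭ x ys z′∈)) (swap y x ↭-refl)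

∈perms⇒↭ : ∀ n {π} → π ∈ perms n → π ↭ range1 n
∈perms⇒↭ zero (here refl) = ↭-refl
∈perms⇒↭ (suc n) π∈ with ∈-concat⁻′ (map (insertions (suc n)) (perms n)) π∈
... | zs , π∈zs , zs∈ with ∈-map⁻ (insertions (suc n)) zs∈
...   | ys , ys∈ , refl =
  ↭-trans (insertions-↭ (suc n) ys π∈zs) (↭-trans (prep (suc n) (∈perms⇒↭ n ys∈)) (↭-sym (range1-↭ n)))

↭⇒∈perms : ∀ n {π} → π ↭ range1 n → π ∈ perms n
↭⇒∈perms zero π↭ rewrite ↭-empty-inv π↭ = here refl
↭⇒∈perms (suc n) {π} π↭ with ∈-∃++ (∈-resp-↭ (↭-sym π↭) (∈-resp-↭ (↭-sym (range1-↭ n)) (here refl)))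
... | a , b , refl =
  ∈-concat⁺′ (∈-insertions (suc n) a b) (∈-map⁺ (insertions (suc n)) (↭⇒∈perms n (drop-mid a [] (↭-trans π↭ (range1-↭ n)))))

remove : ℕ → List ℕ → List ℕ
remove x [] = []
remove x (y ∷ ys) = if does (x ≟ y) then ys else y ∷ remove x ys

remove-insertions : ∀ x ys {z} → x ∉ ys → z ∈ insertions x ys → remove x z ≡ ys
remove-insertions x [] _ (here refl) rewrite dec-true (x ≟ x) refl = refl
remove-insertions x (y ∷ ys) _ (here refl) rewrite dec-true (x ≟ x) refl = refl
remove-insertions x (y ∷ ys) x∉ (there z∈) with ∈-map⁻ (y ∷_) z∈
... | z′ , z′∈ , refl rewrite dec-false (x ≟ y) (λ x≡y → x∉ (here x≡y)) =
  cong (y ∷_) (remove-insertions x ys (λ x∈ → x∉ (there x∈)) z′∈)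

insertions-unique : ∀ x ys → x ∉ ys → Unique (insertions x ys)
insertions-unique x [] _ = [] ∷ []
insertions-unique x (y ∷ ys) x∉ =
  All.tabulate distinct ∷ Unique.map⁺ ∷-injectiveʳ (insertions-unique x ys (λ x∈ → x∉ (there x∈)))
  where
  distinct : ∀ {z} → z ∈ map (y ∷_) (insertions x ys) → (x ∷ y ∷ ys) ≢ z
  distinct z∈ eq with ∈-map⁻ (y ∷_) z∈
  ... | _ , _ , refl = x∉ (here (∷-injectiveˡ eq))

-- The lists f x are pairwise disjoint because key recovers x from any of their members.
Unique-concatMap : ∀ {A B : Set} (f : A → List B) (key : B → A) xs → Unique xs → (∀ {x} → x ∈ xs → Unique (f x)) →
  (∀ {x z} → x ∈ xs → z ∈ f x → key z ≡ x) → Unique (concatMap f xs)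
Unique-concatMap f key [] _ _ _ = []
Unique-concatMap f key (x ∷ xs) (x∉ ∷ u) uf key-inv =
  Unique.++⁺ (uf (here refl)) (Unique-concatMap f key xs u (uf ∘ there) (key-inv ∘ there)) disjoint
  where
  disjoint : ∀ {v} → ¬ (v ∈ f x × v ∈ concatMap f xs)
  disjoint (v∈fx , v∈rest) with ∈-concat⁻′ (map f xs) v∈rest
  ... | ys , v∈ys , ys∈ with ∈-map⁻ f ys∈
  ...   | x′ , x′∈ , refl = All.lookup x∉ x′∈ (trans (sym (key-inv (here refl) v∈fx)) (key-inv (there x′∈) v∈ys))

perms-unique : ∀ n → Unique (perms n)
perms-unique zero = [] ∷ []
perms-unique (suc n) =
  Unique-concatMap (insertions (suc n)) (remove (suc n)) (perms n) (perms-unique n)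
    (λ {ys} ys∈ → insertions-unique (suc n) ys (fresh ys∈))
    (λ {ys} ys∈ z∈ → remove-insertions (suc n) ys (fresh ys∈) z∈)
  where
  fresh : ∀ {ys} → ys ∈ perms n → suc n ∉ ys
  fresh ys∈ 1+n∈ = <-irrefl refl (proj₂ (∈-range1⁻ (∈-resp-↭ (∈perms⇒↭ n ys∈) 1+n∈)))

countᵇ : ∀ {A : Set} → (A → Bool) → List A → ℕ
countᵇ Q xs = length (filterᵇ Q xs)

countᵇ-↭ : ∀ {A : Set} (Q : A → Bool) {xs ys} → xs ↭ ys → countᵇ Q xs ≡ countᵇ Q ys
countᵇ-↭ Q xs↭ys = ↭-length (filter-↭ (T? ∘ Q) xs↭ys)

countᵇ-++ : ∀ {A : Set} (Q : A → Bool) xs ys → countᵇ Q (xs ++ ys) ≡ countᵇ Q xs + countᵇ Q ys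
countᵇ-++ Q xs ys = trans (cong length (filter-++ (T? ∘ Q) xs ys)) (length-++ (filterᵇ Q xs))

countᵇ-concatMap : ∀ {A B : Set} (Q : B → Bool) (f : A → List B) xs →
  countᵇ Q (concatMap f xs) ≡ sum (map (λ x → countᵇ Q (f x)) xs)
countᵇ-concatMap Q f [] = refl
countᵇ-concatMap Q f (x ∷ xs) = trans (countᵇ-++ Q (f x) (concatMap f xs)) (cong (countᵇ Q (f x) +_) (countᵇ-concatMap Q f xs))

countᵇ-map : ∀ {A B : Set} (Q : B → Bool) (g : A → B) xs → countᵇ Q (map g xs) ≡ countᵇ (Q ∘ g) xs
countᵇ-map Q g [] = refl
countᵇ-map Q g (x ∷ xs) with Q (g x)
... | true = cong suc (countᵇ-map Q g xs)
... | false = countᵇ-map Q g xs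

countᵇ-cong : ∀ {A : Set} {Q Q′ : A → Bool} xs → (∀ {x} → x ∈ xs → Q x ≡ Q′ x) → countᵇ Q xs ≡ countᵇ Q′ xs
countᵇ-cong [] _ = refl
countᵇ-cong {Q = Q} {Q′} (x ∷ xs) Q≡ with Q x | Q′ x | Q≡ (here refl)
... | true | true | refl = cong suc (countᵇ-cong xs (Q≡ ∘ there))
... | false | false | refl = countᵇ-cong xs (Q≡ ∘ there)

countᵇ-filterᵇ : ∀ {A : Set} (P Q : A → Bool) xs → countᵇ Q (filterᵇ P xs) ≡ countᵇ (λ x → P x ∧ Q x) xs
countᵇ-filterᵇ P Q [] = refl
countᵇ-filterᵇ P Q (x ∷ xs) with P x
... | false = countᵇ-filterᵇ P Q xs
... | true with Q x
...   | true = cong suc (countᵇ-filterᵇ P Q xs)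
...   | false = countᵇ-filterᵇ P Q xs

countᵇ-∧ˡ : ∀ {A : Set} a (Q : A → Bool) xs → countᵇ (λ x → a ∧ Q x) xs ≡ (if a then countᵇ Q xs else 0)
countᵇ-∧ˡ true Q xs = refl
countᵇ-∧ˡ false Q [] = refl
countᵇ-∧ˡ false Q (x ∷ xs) = countᵇ-∧ˡ false Q xs

↭range1-split : ∀ {a b n} t → a ++ b ↭ range1 n → t ≤ n → (∀ {y} → y ∈ b → y ≤ t) → (∀ {x} → x ∈ a → t < x) →
  b ↭ range1 t × a ↭ map (t +_) (range1 (n ∸ t))
↭range1-split {a} {b} {n} t ab↭ t≤n b≤t t<a =
  subst₂ _↭_ lowAB lowRange (filter-↭ (_≤? t) ab↭) , subst₂ _↭_ highAB highRange (filter-↭ (t <?_) ab↭)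
  where
  upper = map (t +_) (range1 (n ∸ t))
  range1≡ : range1 n ≡ range1 t ++ upper
  range1≡ = trans (cong range1 (sym (m+[n∸m]≡n t≤n))) (range1-+ t (n ∸ t))
  t<upper : ∀ {z} → z ∈ upper → t < z
  t<upper z∈ with ∈-map⁻ (t +_) z∈
  ... | q , q∈ , refl = subst (_< t + q) (+-identityʳ t) (+-monoʳ-< t (proj₁ (∈-range1⁻ q∈)))
  lowAB : filter (_≤? t) (a ++ b) ≡ b
  lowAB = trans (filter-++ (_≤? t) a b)
    (cong₂ _++_ (filter-none (_≤? t) (All.tabulate (λ x∈ → <⇒≱ (t<a x∈)))) (filter-all (_≤? t) (All.tabulate b≤t)))
  lowRange : filter (_≤? t) (range1 n) ≡ range1 t
  lowRange = trans (cong (filter (_≤? t)) range1≡) (trans (filter-++ (_≤? t) (range1 t) upper)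
    (trans (cong₂ _++_ (filter-all (_≤? t) (All.tabulate (λ z∈ → proj₂ (∈-range1⁻ z∈))))
                       (filter-none (_≤? t) (All.tabulate (λ z∈ → <⇒≱ (t<upper z∈)))))
           (++-identityʳ (range1 t))))
  highAB : filter (t <?_) (a ++ b) ≡ a
  highAB = trans (filter-++ (t <?_) a b)
    (trans (cong₂ _++_ (filter-all (t <?_) (All.tabulate t<a)) (filter-none (t <?_) (All.tabulate (λ y∈ → ≤⇒≯ (b≤t y∈)))))
           (++-identityʳ a))
  highRange : filter (t <?_) (range1 n) ≡ upper
  highRange = trans (cong (filter (t <?_)) range1≡) (trans (filter-++ (t <?_) (range1 t) upper)
    (cong₂ _++_ (filter-none (t <?_) (All.tabulate (λ z∈ → ≤⇒≯ (proj₂ (∈-range1⁻ z∈))))) (filter-all (t <?_) (All.tabulate t<upper))))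

p132-nonEmpty : NonEmptyBlocks p132
p132-nonEmpty = (λ ()) ∷ (λ ()) ∷ (λ ()) ∷ []

p132-singletons : SingletonBlocks p132
p132-singletons = refl ∷ refl ∷ refl ∷ []

length≡1⁻ : ∀ (l : List ℕ) → length l ≡ 1 → Σ ℕ λ x → l ≡ x ∷ []
length≡1⁻ (x ∷ []) refl = x , refl

length≡2⁻ : ∀ (l : List ℕ) → length l ≡ 2 → Σ ℕ λ x → Σ ℕ λ y → l ≡ x ∷ y ∷ []
length≡2⁻ (x ∷ y ∷ []) refl = x , y , refl

Contains132-∷-max : ∀ N β → (∀ {y} → y ∈ β → y < N) → Contains p132 (N ∷ β) → Contains p132 β
Contains132-∷-max N β β<N (w , skip fs , iso) = w , fs , iso
Contains132-∷-max N β β<N (_ , factor {v = []} {w = w′} _ fs , iso) with length≡2⁻ w′ (Factors-length fs)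
... | y , z , refl = ⊥-elim (<-asym (proj₁ (ordIso-132⇒ N y z iso)) (β<N (Factors-⊆ fs (there (here refl)))))

Contains132-glue⁻ : ∀ A N β → (∀ {x y} → x ∈ A → y ∈ β → y < x) → (∀ {x} → x ∈ A → x < N) → (∀ {y} → y ∈ β → y < N) →
  Contains p132 (A ++ N ∷ β) → Contains p132 A ⊎ Contains p132 β
Contains132-glue⁻ A N β β<A A<N β<N (w , fs , iso) with Factors-splitAt p132-singletons A (N ∷ β) fs refl
... | splitAt [] _ [] w₂ refl refl done fs₂ = inj₂ (Contains132-∷-max N β β<N (w₂ , fs₂ , iso))
... | splitAt (_ ∷ []) _ w₁ w₂ refl refl fs₁ fs₂ with length≡1⁻ w₁ (Factors-length fs₁) | length≡2⁻ w₂ (Factors-length fs₂)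
...   | x , refl | y , z , refl with ordIso-132⇒ x y z iso | Factors-⊆ fs₂ (there (here refl))
...     | x<z , _   | there z∈β = ⊥-elim (<-asym x<z (β<A (Factors-⊆ fs₁ (here refl)) z∈β))
...     | _   , N<y | here refl = ⊥-elim (<⇒≱ N<y (≤N (Factors-⊆ fs₂ (here refl))))
  where
  ≤N : ∀ {u} → u ∈ N ∷ β → u ≤ N
  ≤N (here refl) = ≤-refl
  ≤N (there u∈β) = <⇒≤ (β<N u∈β)
Contains132-glue⁻ A N β β<A A<N β<N (w , fs , iso) | splitAt (_ ∷ _ ∷ []) _ w₁ w₂ refl refl fs₁ fs₂
  with length≡2⁻ w₁ (Factors-length fs₁) | length≡1⁻ w₂ (Factors-length fs₂)
... | x , y , refl | z , refl with ordIso-132⇒ x y z iso | Factors-⊆ fs₂ (here refl)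
...   | x<z , _   | there z∈β = ⊥-elim (<-asym x<z (β<A (Factors-⊆ fs₁ (here refl)) z∈β))
...   | _   , N<y | here refl = ⊥-elim (<-asym N<y (A<N (Factors-⊆ fs₁ (there (here refl)))))
Contains132-glue⁻ A N β β<A A<N β<N (w , fs , iso) | splitAt (_ ∷ _ ∷ _ ∷ []) [] w₁ [] refl refl fs₁ done =
  inj₁ (w₁ , fs₁ , subst (λ w′ → ordIso (concat p132) w′ ≡ true) (++-identityʳ w₁) iso)

+-orderPreserving : ∀ b → OrderPreserving (b +_)
+-orderPreserving b = strictlyIncreasing⇒OrderPreserving (b +_) (+-monoʳ-< b)

IsPerm : List ℕ → Set
IsPerm α = α ↭ range1 (length α)

∈-IsPerm⁻ : ∀ {α} → IsPerm α → ∀ {x} → x ∈ α → 1 ≤ x × x ≤ length α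
∈-IsPerm⁻ α↭ x∈ = ∈-range1⁻ (∈-resp-↭ α↭ x∈)

glue : List ℕ → List ℕ → List ℕ
glue α β = map (length β +_) α ++ suc (length α + length β) ∷ β

∈-shifted⁻ : ∀ {α} (β : List ℕ) → IsPerm α → ∀ {x} → x ∈ map (length β +_) α → length β < x × x < suc (length α + length β)
∈-shifted⁻ {α} β α↭ x∈ with ∈-map⁻ (length β +_) x∈
... | a , a∈ , refl with ∈-IsPerm⁻ {α} α↭ a∈
...   | 1≤a , a≤ = subst (_< length β + a) (+-identityʳ (length β)) (+-monoʳ-< (length β) 1≤a) ,
                   s≤s (subst (length β + a ≤_) (+-comm (length β) (length α)) (+-monoʳ-≤ (length β) a≤))

glue-avoids132 : ∀ α β → IsPerm α → IsPerm β → avoids p132 α ≡ true → avoids p132 β ≡ true → avoids p132 (glue α β) ≡ true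
glue-avoids132 α β α↭ β↭ avα avβ = ¬Contains⇒avoids p132 (glue α β) p132-nonEmpty λ c →
  [ avoids⇒¬Contains p132 (map (length β +_) α) (trans (cong not (contains-map (length β +_) (+-orderPreserving (length β)) p132 α)) avα)
  , avoids⇒¬Contains p132 β avβ
  ]′ (Contains132-glue⁻ (map (length β +_) α) (suc (length α + length β)) β
        (λ x∈ y∈ → ≤-<-trans (proj₂ (∈-IsPerm⁻ {β} β↭ y∈)) (proj₁ (∈-shifted⁻ {α} β α↭ x∈)))
        (λ x∈ → proj₂ (∈-shifted⁻ {α} β α↭ x∈))
        (λ y∈ → s≤s (≤-trans (proj₂ (∈-IsPerm⁻ {β} β↭ y∈)) (m≤n+m (length β) (length α))))
        c)

glue-avoids132⁻ : ∀ α β → avoids p132 (glue α β) ≡ true → avoids p132 α ≡ true × avoids p132 β ≡ true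
glue-avoids132⁻ α β av =
  ¬Contains⇒avoids p132 α p132-nonEmpty (λ c → ¬glue (Contains-++ʳ p132 A _ (shifted c))) ,
  ¬Contains⇒avoids p132 β p132-nonEmpty (λ c → ¬glue (subst (Contains p132) (++-assoc A [ N ] β) (Contains-++ˡ p132 (A ++ [ N ]) β c)))
  where
  A = map (length β +_) α
  N = suc (length α + length β)
  ¬glue = avoids⇒¬Contains p132 (glue α β) av
  shifted : Contains p132 α → Contains p132 A
  shifted c = contains⇒Contains p132 A p132-nonEmpty
    (trans (contains-map (length β +_) (+-orderPreserving (length β)) p132 α) (Contains⇒contains p132 α c))

Unique-++-disjoint : ∀ (a : List ℕ) {b x y} → Unique (a ++ b) → x ∈ a → y ∈ b → x ≢ y
Unique-++-disjoint (_ ∷ a) (a₀∉ ∷ _) (here refl) y∈ = All.lookup a₀∉ (∈-++⁺ʳ a y∈)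
Unique-++-disjoint (_ ∷ a) (_ ∷ u) (there x∈) y∈ = Unique-++-disjoint a u x∈ y∈

-- Otherwise x N y would be an occurrence of 132.
avoids132-max-split : ∀ a N b → avoids p132 (a ++ N ∷ b) ≡ true → (∀ {y} → y ∈ b → y < N) → Unique (a ++ b) →
  ∀ {x y} → x ∈ a → y ∈ b → y < x
avoids132-max-split a N b av b<N u {x} {y} x∈ y∈ with <-cmp x y
... | tri> _ _ y<x = y<x
... | tri≈ _ x≡y _ = ⊥-elim (Unique-++-disjoint a u x∈ y∈ x≡y)
... | tri< x<y _ _ with ∈-∃++ x∈ | ∈-∃++ y∈
...   | a₁ , a₂ , refl | b₁ , b₂ , refl =
  ⊥-elim (avoids⇒¬Contains p132 _ av (x ∷ N ∷ y ∷ [] , occurrence , ordIso-132⇐ x N y x<y (b<N y∈)))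
  where
  occurrence : Factors p132 ((a₁ ++ x ∷ a₂) ++ N ∷ b₁ ++ y ∷ b₂) (x ∷ N ∷ y ∷ [])
  occurrence = subst (λ z → Factors p132 z (x ∷ N ∷ y ∷ [])) (sym (++-assoc a₁ (x ∷ a₂) (N ∷ b₁ ++ y ∷ b₂)))
    (Factors-++ˡ a₁ (factor {v = []} refl (Factors-++ˡ a₂ (factor {v = []} refl (Factors-++ˡ b₁ (factor {v = []} refl done))))))

record Decomposition (n : ℕ) (π : List ℕ) : Set where
  constructor decomposition
  field
    α β : List ℕ
    π≡ : π ≡ glue α β
    α-perm : IsPerm α
    β-perm : IsPerm β
    size : length α + length β ≡ n

decompose : ∀ n π → π ↭ range1 (suc n) → avoids p132 π ≡ true → Decomposition n π
decompose n π π↭ av with ∈-∃++ (∈-resp-↭ (↭-sym π↭) (∈-range1⁺ {suc n} (s≤s z≤n) ≤-refl))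
... | a , b , refl = decomposition α b π≡ α-perm β-perm size
  where
  ab↭ : a ++ b ↭ range1 n
  ab↭ = drop-mid a [] (↭-trans π↭ (range1-↭ n))
  ab-range : ∀ {x} → x ∈ a ++ b → 1 ≤ x × x ≤ n
  ab-range x∈ = ∈-range1⁻ (∈-resp-↭ ab↭ x∈)
  b<a : ∀ {x y} → x ∈ a → y ∈ b → y < x
  b<a = avoids132-max-split a (suc n) b av (λ y∈ → s≤s (proj₂ (ab-range (∈-++⁺ʳ a y∈)))) (↭range1-unique ab↭)
  t = max 0 b
  t<a : ∀ {x} → x ∈ a → t < x
  t<a x∈ = max<v⁺ (proj₁ (ab-range (∈-++⁺ˡ x∈))) (All.tabulate (b<a x∈))
  t≤n : t ≤ n
  t≤n = max≤v⁺ z≤n (All.tabulate (λ y∈ → proj₂ (ab-range (∈-++⁺ʳ a y∈))))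
  b↭ : b ↭ range1 t
  b↭ = proj₁ (↭range1-split t ab↭ t≤n (All.lookup (xs≤max 0 b)) t<a)
  α = map (_∸ t) a
  α↭ : α ↭ range1 (n ∸ t)
  α↭ = subst (α ↭_) (trans (sym (map-∘ (range1 (n ∸ t)))) (map-id-local (All.tabulate (λ {q} _ → m+n∸m≡n t q))))
         (↭.map⁺ (_∸ t) (proj₂ (↭range1-split t ab↭ t≤n (All.lookup (xs≤max 0 b)) t<a)))
  length-b : length b ≡ t
  length-b = trans (↭-length b↭) (length-range1 t)
  length-α : length α ≡ n ∸ t
  length-α = trans (↭-length α↭) (length-range1 (n ∸ t))
  size : length α + length b ≡ n
  size = trans (cong₂ _+_ length-α length-b) (m∸n+n≡m t≤n)
  unshift : map (length b +_) α ≡ a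
  unshift = trans (cong (λ s → map (s +_) α) length-b)
                  (trans (sym (map-∘ a)) (map-id-local (All.tabulate (λ x∈ → m+[n∸m]≡n (<⇒≤ (t<a x∈))))))
  π≡ : a ++ suc n ∷ b ≡ glue α b
  π≡ = cong₂ (λ u v → u ++ v ∷ b) (sym unshift) (cong suc (sym size))
  α-perm : IsPerm α
  α-perm = subst (λ q → α ↭ range1 q) (sym length-α) α↭
  β-perm : IsPerm b
  β-perm = subst (λ q → b ↭ range1 q) (sym length-b) b↭

glue-↭ : ∀ α β → IsPerm α → IsPerm β → glue α β ↭ range1 (suc (length α + length β))
glue-↭ α β α↭ β↭ = begin
  map (b +_) α ++ N ∷ β                    ↭⟨ ++⁺ (↭.map⁺ (b +_) α↭) (prep N β↭) ⟩
  map (b +_) (range1 a) ++ N ∷ range1 b    ↭⟨ shift N (map (b +_) (range1 a)) (range1 b) ⟩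
  N ∷ map (b +_) (range1 a) ++ range1 b    ↭⟨ prep N (++-comm (map (b +_) (range1 a)) (range1 b)) ⟩
  N ∷ range1 b ++ map (b +_) (range1 a)    ≡⟨ cong₂ _∷_ (cong suc (+-comm a b)) (sym (range1-+ b a)) ⟩
  suc (b + a) ∷ range1 (b + a)             ↭⟨ ↭-sym (range1-↭ (b + a)) ⟩
  range1 (suc (b + a))                     ≡⟨ cong (range1 ∘ suc) (+-comm b a) ⟩
  range1 (suc (a + b))                     ∎
  where
  open PermutationReasoning
  a = length α
  b = length β
  N = suc (a + b)

private
  ++-∷-cancel : ∀ (xs xs′ : List ℕ) {x ys ys′} → x ∉ xs → x ∉ xs′ → xs ++ x ∷ ys ≡ xs′ ++ x ∷ ys′ → xs ≡ xs′ × ys ≡ ys′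
  ++-∷-cancel [] [] _ _ eq = refl , ∷-injectiveʳ eq
  ++-∷-cancel [] (y ∷ xs′) _ x∉xs′ eq = ⊥-elim (x∉xs′ (here (∷-injectiveˡ eq)))
  ++-∷-cancel (y ∷ xs) [] x∉xs _ eq = ⊥-elim (x∉xs (here (sym (∷-injectiveˡ eq))))
  ++-∷-cancel (y ∷ xs) (y′ ∷ xs′) x∉xs x∉xs′ eq with ∷-injective eq
  ... | refl , eq′ with ++-∷-cancel xs xs′ (x∉xs ∘ there) (x∉xs′ ∘ there) eq′
  ...   | refl , ys≡ = refl , ys≡

glue-injective : ∀ {α β α′ β′} → IsPerm α → IsPerm α′ → length α + length β ≡ length α′ + length β′ →
  glue α β ≡ glue α′ β′ → (α , β) ≡ (α′ , β′)
glue-injective {α} {β} {α′} {β′} α↭ α′↭ size≡ eq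
  with ++-∷-cancel (map (length β +_) α) (map (length β′ +_) α′)
         (λ N∈ → <-irrefl refl (proj₂ (∈-shifted⁻ {α} β α↭ N∈)))
         (λ N∈ → <-irrefl (cong suc size≡) (proj₂ (∈-shifted⁻ {α′} β′ α′↭ N∈)))
         (trans eq (cong (λ z → map (length β′ +_) α′ ++ z ∷ β′) (cong suc (sym size≡))))
... | shifted≡ , refl = cong (_, β) (map-injective (λ {x} {y} → +-cancelˡ-≡ (length β) x y) shifted≡)

Av : ℕ → List (List ℕ)
Av n = filterᵇ (avoids p132) (perms n)

∈Av⁻ : ∀ n {α} → α ∈ Av n → α ↭ range1 n × avoids p132 α ≡ true
∈Av⁻ n α∈ with ∈-filter⁻ (T? ∘ avoids p132) {xs = perms n} α∈
... | α∈perms , av = ∈perms⇒↭ n α∈perms , Equivalence.to T-≡ av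

∈Av⁺ : ∀ n {α} → α ↭ range1 n → avoids p132 α ≡ true → α ∈ Av n
∈Av⁺ n α↭ av = ∈-filter⁺ (T? ∘ avoids p132) (↭⇒∈perms n α↭) (Equivalence.from T-≡ av)

Av-length : ∀ n {α} → α ∈ Av n → length α ≡ n
Av-length n α∈ = trans (↭-length (proj₁ (∈Av⁻ n α∈))) (length-range1 n)

Av-IsPerm : ∀ n {α} → α ∈ Av n → IsPerm α
Av-IsPerm n {α} α∈ = subst (λ q → α ↭ range1 q) (sym (Av-length n α∈)) (proj₁ (∈Av⁻ n α∈))

Av-unique : ∀ n → Unique (Av n)
Av-unique n = Unique.filter⁺ (T? ∘ avoids p132) (perms-unique n)

pairs : ℕ → List (List ℕ × List ℕ)
pairs n = concatMap (λ i → cartesianProduct (Av i) (Av (n ∸ i))) (upTo (suc n))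

∈pairs⁻ : ∀ n {α β} → (α , β) ∈ pairs n → Σ ℕ λ i → i ≤ n × α ∈ Av i × β ∈ Av (n ∸ i)
∈pairs⁻ n q∈ with ∈-concat⁻′ (map (λ i → cartesianProduct (Av i) (Av (n ∸ i))) (upTo (suc n))) q∈
... | qs , q∈qs , qs∈ with ∈-map⁻ (λ i → cartesianProduct (Av i) (Av (n ∸ i))) qs∈
...   | i , i∈ , refl = i , ≤-pred (∈-upTo⁻ i∈) , ∈-cartesianProduct⁻ (Av i) (Av (n ∸ i)) q∈qs

∈pairs⁺ : ∀ n {i α β} → i ≤ n → α ∈ Av i → β ∈ Av (n ∸ i) → (α , β) ∈ pairs n
∈pairs⁺ n {i} i≤n α∈ β∈ =
  ∈-concat⁺′ (∈-cartesianProduct⁺ α∈ β∈) (∈-map⁺ (λ i → cartesianProduct (Av i) (Av (n ∸ i))) (∈-upTo⁺ (s≤s i≤n)))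

pairs-size : ∀ n {α β} → (α , β) ∈ pairs n → length α + length β ≡ n
pairs-size n q∈ with ∈pairs⁻ n q∈
... | i , i≤n , α∈ , β∈ = trans (cong₂ _+_ (Av-length i α∈) (Av-length (n ∸ i) β∈)) (m+[n∸m]≡n i≤n)

pairs-unique : ∀ n → Unique (pairs n)
pairs-unique n =
  Unique-concatMap (λ i → cartesianProduct (Av i) (Av (n ∸ i))) (length ∘ proj₁) (upTo (suc n)) (Unique.upTo⁺ (suc n))
    (λ {i} _ → Unique.cartesianProduct⁺ (Av-unique i) (Av-unique (n ∸ i)))
    (λ {i} _ q∈ → Av-length i (proj₁ (∈-cartesianProduct⁻ (Av i) (Av (n ∸ i)) q∈)))

Unique-map⁺-local : ∀ {A B : Set} (g : A → B) xs → Unique xs → (∀ {x y} → x ∈ xs → y ∈ xs → g x ≡ g y → x ≡ y) → Unique (map g xs)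
Unique-map⁺-local g [] _ _ = []
Unique-map⁺-local g (x ∷ xs) (x∉ ∷ u) inj =
  All.tabulate distinct ∷ Unique-map⁺-local g xs u (λ x∈ y∈ → inj (there x∈) (there y∈))
  where
  distinct : ∀ {z} → z ∈ map g xs → g x ≢ z
  distinct z∈ gx≡z with ∈-map⁻ g z∈
  ... | y , y∈ , refl = All.lookup x∉ y∈ (inj (here refl) (there y∈) gx≡z)

glued : ℕ → List (List ℕ)
glued n = map (uncurry glue) (pairs n)

glued-unique : ∀ n → Unique (glued n)
glued-unique n = Unique-map⁺-local (uncurry glue) (pairs n) (pairs-unique n)
  λ { {α , β} {α′ , β′} q∈ q′∈ eq →
      glue-injective (α-perm q∈) (α-perm q′∈) (trans (pairs-size n q∈) (sym (pairs-size n q′∈))) eq }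
  where
  α-perm : ∀ {α β} → (α , β) ∈ pairs n → IsPerm α
  α-perm q∈ with ∈pairs⁻ n q∈
  ... | i , _ , α∈ , _ = Av-IsPerm i α∈

glued⊆Av : ∀ n {π} → π ∈ glued n → π ∈ Av (suc n)
glued⊆Av n π∈ with ∈-map⁻ (uncurry glue) π∈
... | (α , β) , q∈ , refl with ∈pairs⁻ n q∈
...   | i , _ , α∈ , β∈ =
  ∈Av⁺ (suc n) (subst (λ z → glue α β ↭ range1 (suc z)) (pairs-size n q∈) (glue-↭ α β α↭ β↭))
    (glue-avoids132 α β α↭ β↭ (proj₂ (∈Av⁻ i α∈)) (proj₂ (∈Av⁻ (n ∸ i) β∈)))
  where
  α↭ = Av-IsPerm i α∈
  β↭ = Av-IsPerm (n ∸ i) β∈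

Av⊆glued : ∀ n {π} → π ∈ Av (suc n) → π ∈ glued n
Av⊆glued n {π} π∈ with ∈Av⁻ (suc n) π∈
... | π↭ , av with decompose n π π↭ av
...   | decomposition α β refl α↭ β↭ size with glue-avoids132⁻ α β av
...     | avα , avβ = ∈-map⁺ (uncurry glue) (∈pairs⁺ n (subst (length α ≤_) size (m≤m+n (length α) (length β)))
                        (∈Av⁺ (length α) α↭ avα) (subst (β ∈_) (cong Av β-size) (∈Av⁺ (length β) β↭ avβ)))
  where
  β-size : length β ≡ n ∸ length α
  β-size = sym (trans (cong (_∸ length α) (sym size)) (m+n∸m≡n (length α) (length β)))

Av-suc↭glued : ∀ n → Av (suc n) ↭ glued n
Av-suc↭glued n = ∼bag⇒↭ (unique∧set⇒bag (Av-unique (suc n)) (glued-unique n) (mk⇔ (Av⊆glued n) (glued⊆Av n)))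

countᵇ-cartesianProduct : ∀ {A B : Set} (P : A → Bool) (Q : B → Bool) xs ys →
  countᵇ (λ q → P (proj₁ q) ∧ Q (proj₂ q)) (cartesianProduct xs ys) ≡ countᵇ P xs * countᵇ Q ys
countᵇ-cartesianProduct P Q [] ys = refl
countᵇ-cartesianProduct P Q (x ∷ xs) ys =
  trans (countᵇ-++ PQ (map (x ,_) ys) (cartesianProduct xs ys))
        (trans (cong₂ _+_ (trans (countᵇ-map PQ (x ,_) ys) (countᵇ-∧ˡ (P x) Q ys)) (countᵇ-cartesianProduct P Q xs ys)) (first-row (P x) refl))
  where
  PQ = λ (q : _ × _) → P (proj₁ q) ∧ Q (proj₂ q)
  first-row : ∀ b → P x ≡ b → (if b then countᵇ Q ys else 0) + countᵇ P xs * countᵇ Q ys ≡ countᵇ P (x ∷ xs) * countᵇ Q ys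
  first-row b Px≡b with P x
  first-row true refl | .true = refl
  first-row false refl | .false = refl

-- Every 132-avoider of length n+1 is uniquely glue α β, so a predicate that is a
-- conjunction of conditions on α and β is counted by a convolution.
countᵇ-Av-suc : ∀ (Q : List ℕ → Bool) n (P R : ℕ → List ℕ → Bool) →
  (∀ i → i ≤ n → ∀ {α β} → α ∈ Av i → β ∈ Av (n ∸ i) → Q (glue α β) ≡ (P (n ∸ i) α ∧ R (n ∸ i) β)) →
  countᵇ Q (Av (suc n)) ≡ sum (map (λ i → countᵇ (P (n ∸ i)) (Av i) * countᵇ (R (n ∸ i)) (Av (n ∸ i))) (upTo (suc n)))
countᵇ-Av-suc Q n P R Q≡ = begin
  countᵇ Q (Av (suc n))                          ≡⟨ countᵇ-↭ Q (Av-suc↭glued n) ⟩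
  countᵇ Q (glued n)                             ≡⟨ countᵇ-map Q (uncurry glue) (pairs n) ⟩
  countᵇ (Q ∘ uncurry glue) (pairs n)            ≡⟨ countᵇ-concatMap (Q ∘ uncurry glue) (λ i → cartesianProduct (Av i) (Av (n ∸ i))) (upTo (suc n)) ⟩
  sum (map (λ i → countᵇ (Q ∘ uncurry glue) (cartesianProduct (Av i) (Av (n ∸ i)))) (upTo (suc n)))
    ≡⟨ cong sum (map-cong-local (All.tabulate (λ i∈ → count-part _ (≤-pred (∈-upTo⁻ i∈))))) ⟩
  sum (map (λ i → countᵇ (P (n ∸ i)) (Av i) * countᵇ (R (n ∸ i)) (Av (n ∸ i))) (upTo (suc n))) ∎
  where
  open ≡-Reasoning
  count-part : ∀ i → i ≤ n → countᵇ (Q ∘ uncurry glue) (cartesianProduct (Av i) (Av (n ∸ i))) ≡ countᵇ (P (n ∸ i)) (Av i) * countᵇ (R (n ∸ i)) (Av (n ∸ i))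
  count-part i i≤n = trans (countᵇ-cong (cartesianProduct (Av i) (Av (n ∸ i)))
                        (λ q∈ → Q≡ i i≤n (proj₁ (∈-cartesianProduct⁻ (Av i) (Av (n ∸ i)) q∈)) (proj₂ (∈-cartesianProduct⁻ (Av i) (Av (n ∸ i)) q∈))))
                      (countᵇ-cartesianProduct (P (n ∸ i)) (R (n ∸ i)) (Av i) (Av (n ∸ i)))

module TailBlock (d k : ℕ) (d<k : d < k) (τ′ : GPat) (τ′-nonEmpty : NonEmptyBlocks τ′) (τ′↭ : concat τ′ ↭ range1 d) where

  B : List ℕ
  B = block d k

  τ : GPat
  τ = τ′ ++ [ B ]

  m : ℕ
  m = k ∸ d

  0<m : 0 < m
  0<m = m<n⇒0<n∸m d<k

  length-B : length B ≡ m
  length-B = trans (length-map _ (upTo m)) (length-upTo m)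

  B-increasing : Linked _<_ B
  B-increasing = subst (Linked _<_) (sym (map-upTo (λ i → d + suc i) m))
                       (applyUpTo⁺₂ (λ i → d + suc i) m (λ i → +-monoʳ-< d (n<1+n (suc i))))

  τ′<B : ∀ {x x′} → x ∈ concat τ′ → x′ ∈ B → x < x′
  τ′<B {x} x∈ x′∈ with ∈-map⁻ (λ i → d + suc i) x′∈
  ... | i , _ , refl = subst (x <_) (sym (+-suc d i)) (s≤s (≤-trans (proj₂ (∈-range1⁻ (∈-resp-↭ τ′↭ x∈))) (m≤m+n d i)))

  concat-τ : concat τ ≡ concat τ′ ++ B
  concat-τ = trans (sym (concat-++ τ′ [ B ])) (cong (concat τ′ ++_) (++-identityʳ B))

  τ-nonEmpty : NonEmptyBlocks τ
  τ-nonEmpty = AllP.++⁺ τ′-nonEmpty (B≢[] ∷ [])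
    where
    B≢[] : B ≢ []
    B≢[] B≡[] = <-irrefl (sym (trans (sym length-B) (cong length B≡[]))) 0<m

  record TailOcc (π : List ℕ) : Set where
    constructor tailOcc
    field
      P v t w : List ℕ
      π≡ : π ≡ P ++ v ++ t
      factors : Factors τ′ P w
      length-v : length v ≡ m
      iso : ordIso (concat τ′ ++ B) (w ++ v) ≡ true

  Contains⇒TailOcc : ∀ {π} → Contains τ π → TailOcc π
  Contains⇒TailOcc (w , fs , iso) with Factors-split τ′ [ B ] fs
  ... | split p s w₁ w₂ refl refl fs₁ fs₂ with Factors-single fs₂
  ...   | factorOf u t refl len =
    tailOcc (p ++ u) w₂ t w₁ (sym (++-assoc p u (w₂ ++ t))) (Factors-++ʳ fs₁ u) (trans len length-B)
            (subst (λ z → ordIso z (w₁ ++ w₂) ≡ true) concat-τ iso)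

  TailOcc⇒Contains : ∀ {π} → TailOcc π → Contains τ π
  TailOcc⇒Contains (tailOcc P [] t w refl fs len iso) = ⊥-elim (<-irrefl len 0<m)
  TailOcc⇒Contains (tailOcc P (x ∷ v) t w refl fs len iso) =
    w ++ (x ∷ v ++ []) , Factors-join fs (factor {v = v} {ρ = t} (trans len (sym length-B)) done) ,
    subst₂ (λ z z′ → ordIso z (w ++ x ∷ z′) ≡ true) (sym concat-τ) (sym (++-identityʳ v)) iso

  module _ {π : List ℕ} (o : TailOcc π) where
    open TailOcc o

    private
      parts : ordIso (concat τ′) w ≡ true × crossIso (concat τ′) w B v ≡ true × ordIso B v ≡ true
      parts = ordIso-++⁻ (concat τ′) w B v (sym (Factors-length factors)) iso

    TailOcc-increasing : Linked _<_ v
    TailOcc-increasing = ordIso-Linked B v B-increasing (proj₂ (proj₂ parts))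

    TailOcc-below : ∀ {y y′} → y ∈ w → y′ ∈ v → y < y′
    TailOcc-below = crossIso⇒< (concat τ′) w B v (sym (Factors-length factors)) (trans length-B (sym length-v)) τ′<B
                               (proj₁ (proj₂ parts))

    TailOcc-Contains-prefix : Contains τ′ P
    TailOcc-Contains-prefix = w , factors , proj₁ parts

  length-middle : ∀ (g v t : List ℕ) → length v ≤ length (g ++ v ++ t)
  length-middle g v t = ≤-trans (length-++-≤ˡ v) (length-++-≤ʳ (v ++ t) {g})

  TailOcc-short : ∀ π → length π < m → ¬ TailOcc π
  TailOcc-short π π<m (tailOcc P v t w refl _ len _) = <⇒≱ π<m (subst (_≤ length π) len (length-middle P v t))

  TailOcc-run⁻ : ∀ α run → length run ≡ m → TailOcc (α ++ run) → Contains τ′ α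
  TailOcc-run⁻ α run len-run o@(tailOcc P v t w π≡ fs len _) with ++-split P (v ++ t) α run (sym π≡)
  ... | inj₂ (e , _ , refl , _) = Contains-++ʳ τ′ P e (TailOcc-Contains-prefix o)
  ... | inj₁ ([] , refl , _) = subst (Contains τ′) (++-identityʳ α) (TailOcc-Contains-prefix o)
  ... | inj₁ (x ∷ e , refl , run≡) =
    ⊥-elim (<-irrefl refl (≤-trans (s≤s (length-middle e v t)) (≤-reflexive (trans (cong length (sym run≡)) (trans len-run (sym len))))))

  TailOcc-run⁺ : ∀ α run → length run ≡ m → Linked _<_ run → (∀ {x y} → x ∈ α → y ∈ run → x < y) → Contains τ′ α → TailOcc (α ++ run)
  TailOcc-run⁺ α run len-run inc α<run (w , fs , iso) =
    tailOcc α run [] w (cong (α ++_) (sym (++-identityʳ run))) fs len-run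
      (ordIso-++⁺ (concat τ′) w B run (sym (Factors-length fs)) iso
        (<⇒crossIso (concat τ′) w B run τ′<B (λ y∈ y′∈ → α<run (Factors-⊆ fs y∈) y′∈))
        (Linked⇒ordIso B run B-increasing inc (trans length-B (sym len-run))))

  head-below : ∀ {N h₀ rest} β R → (∀ {y} → y ∈ β → y < N) → (β ≡ [] → R ≡ []) → β ++ R ≡ h₀ ∷ rest → h₀ < N
  head-below [] R _ β≡[]⇒ eq with β≡[]⇒ refl
  head-below [] _ _ _ () | refl
  head-below (b₀ ∷ β) R β<N _ eq = subst (_< _) (∷-injectiveˡ eq) (β<N (here refl))

  -- The block cannot run from N into β ρ: it is increasing, and what follows N is smaller than N.
  block-in-left : ∀ {A N β R P v t w} → (∀ {y} → y ∈ β → y < N) → (β ≡ [] → R ≡ []) →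
    Factors τ′ P w → length v ≡ m → ordIso (concat τ′ ++ B) (w ++ v) ≡ true → Linked _<_ v →
    ∀ e → e ≢ [] → A ++ [ N ] ≡ P ++ e → v ++ t ≡ e ++ β ++ R → Contains τ (A ++ [ N ])
  block-in-left {A} {N} {β} {R} {P} {v} {t} {w} β<N β≡[]⇒ fs len iso inc e e≢[] A≡ vt≡ with ++-split v t e (β ++ R) vt≡
  ... | inj₂ (h , _ , refl , _) = TailOcc⇒Contains (tailOcc P v h w A≡ fs len iso)
  ... | inj₁ ([] , v≡ , _) =
    TailOcc⇒Contains (tailOcc P v [] w (trans A≡ (cong (P ++_) (trans (sym (trans v≡ (++-identityʳ e))) (sym (++-identityʳ v))))) fs len iso)
  ... | inj₁ (h₀ ∷ h , refl , βR≡) with ∷ʳ-suffix A N P e e≢[] A≡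
  ...   | e′ , refl = ⊥-elim (<-asym N<h₀ (head-below β R β<N β≡[]⇒ βR≡))
    where
    N<h₀ : N < h₀
    N<h₀ = Linked-middle e′ (subst (Linked _<_) (++-assoc e′ [ N ] (h₀ ∷ h)) inc)


  -- A block starting in β ρ starts in β (ρ is too short), so it lies below A N and hence
  -- so does the occurrence of τ′ before it.
  block-in-right : ∀ {A N β R e v t w} → (∀ {x y} → x ∈ A → y ∈ β → y < x) → (∀ {y} → y ∈ β → y < N) → length R < m →
    Factors τ′ ((A ++ [ N ]) ++ e) w → length v ≡ m → ordIso (concat τ′ ++ B) (w ++ v) ≡ true →
    (∀ {y y′} → y ∈ w → y′ ∈ v → y < y′) → β ++ R ≡ e ++ v ++ t → TailOcc (β ++ R)
  block-in-right {v = []} _ _ _ _ len _ _ _ = ⊥-elim (<-irrefl len 0<m)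
  block-in-right {A} {N} {β} {R} {e} {v₀ ∷ v} {t} {w} β<A β<N R<m fs len iso w<v βR≡ with ++-split e (v₀ ∷ v ++ t) β R (sym βR≡)
  ... | inj₁ (g , refl , R≡) =
    ⊥-elim (<⇒≱ R<m (subst (_≤ length R) len (subst (length (v₀ ∷ v) ≤_) (cong length (sym R≡)) (length-middle g (v₀ ∷ v) t))))
  ... | inj₂ ([] , []≢[] , _ , _) = ⊥-elim ([]≢[] refl)
  ... | inj₂ (g₀ ∷ g , _ , refl , v≡) = tailOcc e (v₀ ∷ v) t w βR≡ fs′ len iso
    where
    g₀∈β : g₀ ∈ e ++ g₀ ∷ g
    g₀∈β = ∈-++⁺ʳ e (here refl)
    g₀<AN : ∀ {z} → z ∈ A ++ [ N ] → g₀ < z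
    g₀<AN z∈ with ∈-++⁻ A z∈
    ... | inj₁ z∈A = β<A z∈A g₀∈β
    ... | inj₂ (here refl) = β<N g₀∈β
    fs′ : Factors τ′ e w
    fs′ with Factors-dropPrefix (A ++ [ N ]) e fs refl
    ... | inj₂ fs″ = fs″
    ... | inj₁ (z , z∈w , z∈AN) = ⊥-elim (<-asym (subst (z <_) (∷-injectiveˡ v≡) (w<v z∈w (here refl))) (g₀<AN z∈AN))

  TailOcc-glue : ∀ A N β R → (∀ {x y} → x ∈ A → y ∈ β → y < x) → (∀ {y} → y ∈ β → y < N) → length R < m → (β ≡ [] → R ≡ []) →
    TailOcc ((A ++ [ N ]) ++ (β ++ R)) → Contains τ (A ++ [ N ]) ⊎ TailOcc (β ++ R)
  TailOcc-glue A N β R β<A β<N R<m β≡[]⇒ o@(tailOcc P v t w π≡ fs len iso) with ++-split P (v ++ t) (A ++ [ N ]) (β ++ R) (sym π≡)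
  ... | inj₂ (e , e≢[] , A≡ , vt≡) = inj₁ (block-in-left β<N β≡[]⇒ fs len iso (TailOcc-increasing o) e e≢[] A≡ vt≡)
  ... | inj₁ (e , refl , βR≡) = inj₂ (block-in-right β<A β<N R<m fs len iso (TailOcc-below o) βR≡)

  avoids-short : ∀ π → length π < m → avoids τ π ≡ true
  avoids-short π π<m = ¬Contains⇒avoids τ π τ-nonEmpty (TailOcc-short π π<m ∘ Contains⇒TailOcc)

  avoids-run : ∀ α run → length run ≡ m → Linked _<_ run → (∀ {x y} → x ∈ α → y ∈ run → x < y) →
    avoids τ (α ++ run) ≡ avoids τ′ α
  avoids-run α run len-run inc α<run = avoids-cong τ (α ++ run) τ′ α τ-nonEmpty τ′-nonEmpty
    (TailOcc-run⁻ α run len-run ∘ Contains⇒TailOcc) (TailOcc⇒Contains ∘ TailOcc-run⁺ α run len-run inc α<run)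

  avoids-glue : ∀ A N β R → (∀ {x y} → x ∈ A → y ∈ β → y < x) → (∀ {y} → y ∈ β → y < N) → length R < m → (β ≡ [] → R ≡ []) →
    avoids τ ((A ++ [ N ]) ++ (β ++ R)) ≡ (avoids τ (A ++ [ N ]) ∧ avoids τ (β ++ R))
  avoids-glue A N β R β<A β<N R<m β≡[]⇒ = avoids-++ τ (A ++ [ N ]) (β ++ R) τ-nonEmpty
    λ c → map₂ TailOcc⇒Contains (TailOcc-glue A N β R β<A β<N R<m β≡[]⇒ (Contains⇒TailOcc c))

  run : ℕ → ℕ → List ℕ
  run ℓ r = applyUpTo (λ i → suc (ℓ + i)) r

  length-run : ∀ ℓ r → length (run ℓ r) ≡ r
  length-run ℓ r = length-applyUpTo _ r

  run-above : ∀ ℓ r {x} → x ∈ run ℓ r → ℓ < x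
  run-above ℓ r x∈ with ∈-applyUpTo⁻ (λ i → suc (ℓ + i)) x∈
  ... | i , _ , refl = s≤s (m≤m+n ℓ i)

  run-increasing : ∀ ℓ r → Linked _<_ (run ℓ r)
  run-increasing ℓ r = applyUpTo⁺₂ _ r (λ i → s≤s (+-monoʳ-< ℓ (n<1+n i)))

  applyUpTo-cong : ∀ {f g : ℕ → ℕ} n → (∀ i → f i ≡ g i) → applyUpTo f n ≡ applyUpTo g n
  applyUpTo-cong zero _ = refl
  applyUpTo-cong (suc n) f≡g = cong₂ _∷_ (f≡g 0) (applyUpTo-cong n (f≡g ∘ suc))

  avoidsWithRun : ℕ → List ℕ → Bool
  avoidsWithRun r π = avoids τ (π ++ run (length π) r)

  avoidsWithRun-glue-[] : ∀ r α → avoidsWithRun r (glue α []) ≡ avoidsWithRun (suc r) α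
  avoidsWithRun-glue-[] r α = cong (avoids τ) (begin
    (map (0 +_) α ++ [ N ]) ++ run (length (glue α [])) r ≡⟨ ++-assoc (map (0 +_) α) [ N ] _ ⟩
    map (0 +_) α ++ N ∷ run (length (glue α [])) r      ≡⟨ cong₂ (λ u v → u ++ N ∷ v) (map-id α) (applyUpTo-cong r shifted) ⟩
    α ++ run (length α) (suc r)                        ∎)
    where
    open ≡-Reasoning
    N = suc (length α + 0)
    length-glue : length (glue α []) ≡ suc (length α)
    length-glue = trans (length-++ (map (0 +_) α)) (trans (cong (_+ 1) (length-map (0 +_) α)) (+-comm (length α) 1))
    shifted : ∀ i → suc (length (glue α []) + i) ≡ suc (length α + suc i)
    shifted i = cong suc (trans (cong (_+ i) length-glue) (sym (+-suc (length α) i)))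

  -- The letters of β ρ keep their relative order when the letters above β are moved up past α′ N.
  liftAbove : ℕ → ℕ → ℕ → ℕ
  liftAbove s b x = if x ≤ᵇ b then x else s + x

  liftAbove-≤ : ∀ s b {x} → x ≤ b → liftAbove s b x ≡ x
  liftAbove-≤ s b x≤b rewrite ≤⇒≤ᵇ≡true x≤b = refl

  liftAbove-> : ∀ s b {x} → b < x → liftAbove s b x ≡ s + x
  liftAbove-> s b b<x rewrite >⇒≤ᵇ≡false b<x = refl

  liftAbove-< : ∀ s b {x y} → x < y → liftAbove s b x < liftAbove s b y
  liftAbove-< s b {x} {y} x<y with x ≤? b | y ≤? b
  ... | yes x≤b | yes y≤b rewrite liftAbove-≤ s b x≤b | liftAbove-≤ s b y≤b = x<y
  ... | yes x≤b | no y≰b rewrite liftAbove-≤ s b x≤b | liftAbove-> s b (≰⇒> y≰b) = <-≤-trans x<y (m≤n+m y s)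
  ... | no x≰b | yes y≤b = ⊥-elim (x≰b (≤-trans (<⇒≤ x<y) y≤b))
  ... | no x≰b | no y≰b rewrite liftAbove-> s b (≰⇒> x≰b) | liftAbove-> s b (≰⇒> y≰b) = +-monoʳ-< s x<y

  avoidsWithRun-glue : ∀ r → r < m → ∀ {α β} → IsPerm α → IsPerm β → β ≢ [] →
    avoidsWithRun r (glue α β) ≡ (avoidsWithRun 1 α ∧ avoidsWithRun r β)
  avoidsWithRun-glue r r<m {α} {β} α↭ β↭ β≢[] = begin
    avoids τ (glue α β ++ ρ)                           ≡⟨ cong (avoids τ) (trans (++-assoc A (N ∷ β) ρ) (sym (++-assoc A [ N ] (β ++ ρ)))) ⟩
    avoids τ ((A ++ [ N ]) ++ (β ++ ρ))                ≡⟨ avoids-glue A N β ρ β<A β<N ρ<m (λ β≡[] → ⊥-elim (β≢[] β≡[])) ⟩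
    avoids τ (A ++ [ N ]) ∧ avoids τ (β ++ ρ)          ≡⟨ cong₂ _∧_ left right ⟩
    avoidsWithRun 1 α ∧ avoidsWithRun r β              ∎
    where
    open ≡-Reasoning
    a = length α
    b = length β
    A = map (b +_) α
    N = suc (a + b)
    L = length (glue α β)
    ρ = run L r
    length-glue : L ≡ a + suc b
    length-glue = trans (length-++ A) (cong (_+ suc b) (length-map (b +_) α))
    β<A : ∀ {x y} → x ∈ A → y ∈ β → y < x
    β<A x∈ y∈ = ≤-<-trans (proj₂ (∈-IsPerm⁻ {β} β↭ y∈)) (proj₁ (∈-shifted⁻ {α} β α↭ x∈))
    β<N : ∀ {y} → y ∈ β → y < N
    β<N y∈ = s≤s (≤-trans (proj₂ (∈-IsPerm⁻ {β} β↭ y∈)) (m≤n+m b a))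
    ρ<m : length ρ < m
    ρ<m = subst (_< m) (sym (length-run L r)) r<m
    left : avoids τ (A ++ [ N ]) ≡ avoids τ (α ++ run a 1)
    left = trans (cong (avoids τ) (trans (cong (λ z → A ++ [ z ]) N≡) (sym (map-++ (b +_) α (run a 1)))))
                 (cong not (contains-map (b +_) (+-orderPreserving b) τ (α ++ run a 1)))
      where
      N≡ : N ≡ b + suc (a + 0)
      N≡ = sym (trans (cong (λ z → b + suc z) (+-identityʳ a)) (trans (+-suc b a) (cong suc (+-comm b a))))
    right : avoids τ (β ++ ρ) ≡ avoids τ (β ++ run b r)
    right = trans (cong (avoids τ) (sym lifted))
                  (cong not (contains-map (liftAbove (suc a) b) (strictlyIncreasing⇒OrderPreserving _ (liftAbove-< (suc a) b)) τ (β ++ run b r)))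
      where
      lifted : map (liftAbove (suc a) b) (β ++ run b r) ≡ β ++ ρ
      lifted = trans (map-++ (liftAbove (suc a) b) β (run b r)) (cong₂ _++_
        (map-id-local (All.tabulate (λ y∈ → liftAbove-≤ (suc a) b (proj₂ (∈-IsPerm⁻ {β} β↭ y∈)))))
        (trans (map-applyUpTo _ (liftAbove (suc a) b) r) (applyUpTo-cong r (λ q →
          trans (liftAbove-> (suc a) b (s≤s (m≤m+n b q)))
                (cong suc (trans (sym (+-assoc a (suc b) q)) (cong (_+ q) (sym length-glue))))))))

  h : ℕ → Series
  h r n = countᵇ (avoidsWithRun r) (Av n)

  f≡h₀ : ∀ n → f τ n ≡ h 0 n
  f≡h₀ n = sym (trans (countᵇ-filterᵇ (avoids p132) (avoidsWithRun 0) (perms n))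
                      (countᵇ-cong (perms n) (λ {π} _ → cong (λ z → avoids p132 π ∧ avoids τ z) (++-identityʳ π))))

  h-top : ∀ n → h m n ≡ f τ′ n
  h-top n = trans (countᵇ-cong (Av n) avoids-τ′) (countᵇ-filterᵇ (avoids p132) (avoids τ′) (perms n))
    where
    avoids-τ′ : ∀ {α} → α ∈ Av n → avoidsWithRun m α ≡ avoids τ′ α
    avoids-τ′ {α} α∈ = avoids-run α (run (length α) m) (length-run _ m) (run-increasing _ m)
      (λ x∈ y∈ → ≤-<-trans (proj₂ (∈-IsPerm⁻ {α} (Av-IsPerm n α∈) x∈)) (run-above (length α) m y∈))

  h-one : ∀ r → r < m → h r 0 ≡ 1
  h-one r r<m rewrite avoids-short (run 0 r) (subst (_< m) (sym (length-run 0 r)) r<m) = refl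

  leftCondition rightCondition : ℕ → ℕ → List ℕ → Bool
  leftCondition r zero = avoidsWithRun (suc r)
  leftCondition r (suc _) = avoidsWithRun 1
  rightCondition r zero _ = true
  rightCondition r (suc _) = avoidsWithRun r

  avoidsWithRun-glue-split : ∀ r → r < m → ∀ i j {α β} → α ∈ Av i → β ∈ Av j →
    avoidsWithRun r (glue α β) ≡ (leftCondition r j α ∧ rightCondition r j β)
  avoidsWithRun-glue-split r r<m i zero {α} _ (here refl) = trans (avoidsWithRun-glue-[] r α) (sym (∧-identityʳ _))
  avoidsWithRun-glue-split r r<m i (suc j) α∈ β∈ =
    avoidsWithRun-glue r r<m (Av-IsPerm i α∈) (Av-IsPerm (suc j) β∈) (λ β≡[] → 0≢1+n (trans (cong length (sym β≡[])) (Av-length (suc j) β∈)))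

  h-tail : ∀ r → r < m → tailˢ (h r) ≗ h (suc r) ⊕ (X ⊛ (h 1 ⊛ tailˢ (h r)))
  h-tail r r<m n = begin
    h r (suc n)                              ≡⟨ countᵇ-Av-suc (avoidsWithRun r) n (leftCondition r) (rightCondition r)
                                                  (λ i _ → avoidsWithRun-glue-split r r<m i (n ∸ i)) ⟩
    sum (map (term n) (upTo (suc n)))        ≡⟨ sum-map-upTo (term n) (suc n) ⟩
    sumBelow (term n) (suc n)                ≡⟨ sumBelow-suc (term n) n ⟩
    sumBelow (term n) n + term n n           ≡⟨ cong₂ _+_ (lower n) (last n) ⟩
    (X ⊛ (h 1 ⊛ tailˢ (h r))) n + h (suc r) n ≡⟨ +-comm _ (h (suc r) n) ⟩
    h (suc r) n + (X ⊛ (h 1 ⊛ tailˢ (h r))) n ∎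
    where
    open ≡-Reasoning
    term : ℕ → ℕ → ℕ
    term n i = countᵇ (leftCondition r (n ∸ i)) (Av i) * countᵇ (rightCondition r (n ∸ i)) (Av (n ∸ i))
    last : ∀ n → term n n ≡ h (suc r) n
    last n rewrite n∸n≡0 n = *-identityʳ _
    lower : ∀ n → sumBelow (term n) n ≡ (X ⊛ (h 1 ⊛ tailˢ (h r))) n
    lower zero = sym (X⊛-zero (h 1 ⊛ tailˢ (h r)))
    lower (suc n) = begin
      sumBelow (term (suc n)) (suc n)              ≡⟨ sumBelow-cong (suc n) (λ i i≤n → cong (λ j → term′ j i) (+-∸-assoc 1 (≤-pred i≤n))) ⟩
      sumBelow (λ i → h 1 i * tailˢ (h r) (n ∸ i)) (suc n) ≡⟨ sum-map-upTo (λ i → h 1 i * tailˢ (h r) (n ∸ i)) (suc n) ⟨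
      (h 1 ⊛ tailˢ (h r)) n                        ≡⟨ X⊛-suc (h 1 ⊛ tailˢ (h r)) n ⟨
      (X ⊛ (h 1 ⊛ tailˢ (h r))) (suc n)            ∎
      where
      term′ : ℕ → ℕ → ℕ
      term′ j i = countᵇ (leftCondition r j) (Av i) * countᵇ (rightCondition r j) (Av j)

theorem2p7 : (d k : ℕ) → 1 ≤ d → d < k →
    (τ' : GPat) → All (λ b → b ≢ []) τ' → concat τ' ↭ range1 d →
    (n : ℕ) →
    f (τ' ++ [ block d k ]) n
      ≡ (ΣS (k ∸ d) (λ j → (X ⊛ f (τ' ++ [ block d k ])) ^ˢ j)
         ⊕ (((X ^ˢ (k ∸ d)) ⊛ (f (τ' ++ [ block d k ]) ^ˢ (k ∸ d))) ⊛ f τ')) n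
theorem2p7 d k _ d<k τ′ τ′-nonEmpty τ′↭ n = begin
  f τ n                        ≡⟨ f≡h₀ n ⟩
  h 0 n                        ≡⟨ Ladder.solution m h (f τ′) h-top h-one h-tail n ⟩
  closedForm m (h 0) (f τ′) n  ≡⟨ closedForm-congˡ m (f τ′) (λ i → sym (f≡h₀ i)) n ⟩
  closedForm m (f τ) (f τ′) n  ∎
  where
  open ≡-Reasoning
  open TailBlock d k d<k τ′ τ′-nonEmpty τ′↭
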